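{- Let $S$ be a finite Kleene relation algebra satisfying the Tarski rule, containing elements $\mathsf{Z}, \mathsf{S}$ such that $\mathsf{Z}$ is a point, $\mathsf{S}$ is an injective mapping and $(\mathsf{S}^T)^*\cdot\mathsf{Z} = \top$; let $\mathsf{S'} = \mathsf{S}\sqcap\overline{\mathsf{Z}^T}$. For $p \in S$ and a point $x$ let $\mathrm{root}(p,x) = ((p^T)^*\cdot x)\sqcap((p\sqcap 1)\cdot\top)$, and for a vector $v$ and $z\in S$ let $p[v\mapsto z] = (v\sqcap z^T)\sqcup(\overline v\sqcap p)$. Say $(p,\mathit{rank})$ has the rank property if $\mathit{rank}$ is a mapping, $(p\sqcap\overline{1})\cdot\mathit{rank}\sqsubseteq \mathit{rank}\cdot\mathsf{S'}^+$, and there exists an injective univalent $i\in S$ with $(p\sqcap 1)\cdot\top \sqsubseteq i\cdot\overline{\mathsf{S'}^+\cdot\mathit{rank}^T\cdot\top}$. Let $p_0$ be a forest, $x, y$ points, and $\mathit{rank}_0\in S$ such that $(p_0,\mathit{rank}_0)$ has the rank property. Run, from $p = p_0$, $\mathit{rank} = \mathit{rank}_0$, the program: $r := \mathrm{root}(p,x)$; $p := p[(p^T)^*\cdot x\mapsto r]$; $s := \mathrm{root}(p,y)$; $p := p[(p^T)^*\cdot y \mapsto s]$; if $r\neq s$ then (if $\mathit{rank}^T\cdot r \sqsubseteq \mathsf{S'}^+\cdot\mathit{rank}^T\cdot s$ then $p := p[r\mapsto s]$ else ($p := p[s\mapsto r]$; if $\mathit{rank}^T\cdot r = \mathit{rank}^T\cdot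 s$ then $\mathit{rank} := \mathit{rank}[r\mapsto \mathsf{S'}^T\cdot\mathit{rank}^T\cdot r]$)). Then in the final state $p$ is a forest, $x$ and $y$ are points, $p^*\cdot(p^T)^* = (p_0\sqcup x\cdot y^T\sqcup (p_0\sqcup x\cdot y^T)^T)^*$, and $(p,\mathit{rank})$ has the rank property.
   Context: A Kleene relation algebra is a structure $(S,\sqcup,\sqcap,\cdot,\overline{\phantom{x}},{}^T,{}^*,\bot,\top,1)$ such that $(S,\sqcup,\sqcap,\overline{\phantom{x}},\bot,\top)$ is a Boolean algebra with order $x \sqsubseteq y \iff x \sqcup y = y$; $(S,\sqcup,\cdot,\bot,1)$ is an idempotent semiring ($\cdot$ associative with two-sided unit $1$, distributing over $\sqcup$, $\bot$ a two-sided zero of $\cdot$); transposition satisfies $(x\sqcup y)^T = x^T \sqcup y^T$, $(x^T)^T = x$, $(x\cdot y)^T = y^T\cdot x^T$ and $(x\cdot y)\sqcap z \sqsubseteq x\cdot(y\sqcap(x^T\cdot z))$; and the star satisfies $1\sqcup y\cdot y^* = y^* = 1 \sqcup y^*\cdot y$, $z\sqcup y\cdot x\sqsubseteq x \Rightarrow y^*\cdot z\sqsubseteq x$, $z \sqcup x\cdot y \sqsubseteq x \Rightarrow z\cdot y^*\sqsubseteq x$. The Tarski rule states $\top\cdot x\cdot\top = \top$ for every $x \neq \bot$. Write $x^+ = x\cdot x^*$. An element $x$ is univalent if $x^T x\sqsubseteq 1$, total if $1\sqsubseteq x x^T$, a mapping if univalent and total, injective if $x x^T\sqsubseteq 1$,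 surjective if $1\sqsubseteq x^T x$, a vector if $x\cdot\top = x$, a point if it is an injective surjective vector, acyclic if $x^+\sqsubseteq\overline 1$, and a forest if it is a mapping and $x\sqcap\overline{1}$ is acyclic. Programs are sequential with the usual semantics. Ranks are numbers encoded as points: $\mathsf{Z}$ is $0$, $\mathsf{S'}^T\cdot n$ is the successor of $n$, and $n < m$ means $n\sqsubseteq\mathsf{S'}^+\cdot m$; $\mathit{rank}^T\cdot r$ is the rank of node $r$. The existence of the injective univalent $i$ expresses that the number of roots is at most the number of ranks not below the maximal rank. In the program, $p[(p^T)^*x\mapsto r]$ is path compression (setting every ancestor of $x$ to point to its root $r$). -}

module Defs where

open import Level using (Level; suc; _⊔_)
open import Data.Product using (Σ; ∃; _×_; _,_)
open import Data.List using (List)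
open import Data.List.Membership.Propositional using (_∈_)
open import Relation.Binary.PropositionalEquality using (_≡_)
open import Relation.Nullary using (¬_)
open import Algebra.Lattice.Structures using (IsBooleanAlgebra)
open import Algebra.Structures using (IsIdempotentSemiring)

record KleeneRelationAlgebra (a : Level) : Set (suc a) where
  infixr 6 _⊔ₛ_
  infixr 7 _⊓_
  infixr 8 _·_
  infix  4 _⊑_
  field
    S    : Set a
    _⊔ₛ_ : S → S → S
    _⊓_  : S → S → S
    _·_  : S → S → S
    ‾_   : S → S
    _ᵀ   : S → S
    _⋆   : S → S
    ⊥ₛ   : S
    ⊤ₛ   : S
    𝟙    : S

  _⊑_ : S → S → Set a
  x ⊑ y = x ⊔ₛ y ≡ y

  field
    isBooleanAlgebra     : IsBooleanAlgebra _≡_ _⊔ₛ_ _⊓_ ‾_ ⊤ₛ ⊥ₛ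
    isIdempotentSemiring : IsIdempotentSemiring _≡_ _⊔ₛ_ _·_ ⊥ₛ 𝟙
    ᵀ-⊔       : ∀ x y → (x ⊔ₛ y) ᵀ ≡ (x ᵀ) ⊔ₛ (y ᵀ)
    ᵀ-invol   : ∀ x → (x ᵀ) ᵀ ≡ x
    ᵀ-·       : ∀ x y → (x · y) ᵀ ≡ (y ᵀ) · (x ᵀ)
    dedekind  : ∀ x y z → (x · y) ⊓ z ⊑ x · (y ⊓ ((x ᵀ) · z))
    star-unfoldˡ : ∀ y → 𝟙 ⊔ₛ (y · (y ⋆)) ≡ y ⋆
    star-unfoldʳ : ∀ y → 𝟙 ⊔ₛ ((y ⋆) · y) ≡ y ⋆
    star-inductˡ : ∀ x y z → z ⊔ₛ (y · x) ⊑ x → (y ⋆) · z ⊑ x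
    star-inductʳ : ∀ x y z → z ⊔ₛ (x · y) ⊑ x → z · (y ⋆) ⊑ x

Finite : ∀ {a} → Set a → Set a
Finite A = Σ (List A) λ l → ∀ x → x ∈ l

module KRA {a : Level} (K : KleeneRelationAlgebra a) where
  open KleeneRelationAlgebra K public

  TarskiRule : Set a
  TarskiRule = ∀ x → ¬ (x ≡ ⊥ₛ) → (⊤ₛ · x) · ⊤ₛ ≡ ⊤ₛ

  _⁺ : S → S
  x ⁺ = x · (x ⋆)

  univalent injective total surjective mapping vector point acyclic forest : S → Set a
  univalent x  = (x ᵀ) · x ⊑ 𝟙
  total x      = 𝟙 ⊑ x · (x ᵀ)
  mapping x    = univalent x × total x
  injective x  = x · (x ᵀ) ⊑ 𝟙
  surjective x = 𝟙 ⊑ (x ᵀ) · x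
  vector x     = x · ⊤ₛ ≡ x
  point x      = vector x × injective x × surjective x
  acyclic x    = x ⁺ ⊑ ‾ 𝟙
  forest x     = mapping x × acyclic (x ⊓ ‾ 𝟙)

  root : S → S → S
  root p x = (((p ᵀ) ⋆) · x) ⊓ ((p ⊓ 𝟙) · ⊤ₛ)

  upd : S → S → S → S
  upd p v z = (v ⊓ (z ᵀ)) ⊔ₛ ((‾ v) ⊓ p)

  rankProperty : S → S → S → Set a
  rankProperty S' p rank =
    mapping rank
    × ((p ⊓ ‾ 𝟙) · rank ⊑ rank · (S' ⁺))
    × ∃ λ i → injective i × univalent i
              × ((p ⊓ 𝟙) · ⊤ₛ ⊑ i · ‾ (((S' ⁺) · (rank ᵀ)) · ⊤ₛ))

  -- Big-step relational semantics of the union program.  The program is deterministic;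
  -- each branch records its guard (or its negation).
  data Exec (S' x y p₀ rank₀ : S) : S → S → Set a where
    same : let r  = root p₀ x
               p₁ = upd p₀ (((p₀ ᵀ) ⋆) · x) r
               s  = root p₁ y
               p₂ = upd p₁ (((p₁ ᵀ) ⋆) · y) s
           in r ≡ s → Exec S' x y p₀ rank₀ p₂ rank₀
    link-r→s : let r  = root p₀ x
                   p₁ = upd p₀ (((p₀ ᵀ) ⋆) · x) r
                   s  = root p₁ y
                   p₂ = upd p₁ (((p₁ ᵀ) ⋆) · y) s
               in ¬ (r ≡ s)
                  → (rank₀ ᵀ) · r ⊑ ((S' ⁺) · (rank₀ ᵀ)) · s
                  → Exec S' x y p₀ rank₀ (upd p₂ r s) rank₀
    link-s→r-eq : let r  = root p₀ x
                      p₁ = upd p₀ (((p₀ ᵀ) ⋆) · x) r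
                      s  = root p₁ y
                      p₂ = upd p₁ (((p₁ ᵀ) ⋆) · y) s
                  in ¬ (r ≡ s)
                     → ¬ ((rank₀ ᵀ) · r ⊑ ((S' ⁺) · (rank₀ ᵀ)) · s)
                     → (rank₀ ᵀ) · r ≡ (rank₀ ᵀ) · s
                     → Exec S' x y p₀ rank₀ (upd p₂ s r)
                            (upd rank₀ r ((S' ᵀ) · ((rank₀ ᵀ) · r)))
    link-s→r-neq : let r  = root p₀ x
                       p₁ = upd p₀ (((p₀ ᵀ) ⋆) · x) r
                       s  = root p₁ y
                       p₂ = upd p₁ (((p₁ ᵀ) ⋆) · y) s
                   in ¬ (r ≡ s)
                      → ¬ ((rank₀ ᵀ) · r ⊑ ((S' ⁺) · (rank₀ ᵀ)) · s)
                      → ¬ ((rank₀ ᵀ) · r ≡ (rank₀ ᵀ) · s)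
                      → Exec S' x y p₀ rank₀ (upd p₂ s r) rank₀

module Submission where

-- Both path compressions only redirect nodes of the path from x (resp. y) to their root, and
-- linking adds one edge between two distinct roots, so p stays a forest and its equivalence
-- closure grows exactly by the pair (x, y). Finiteness and acyclicity guarantee that every node
-- reaches a root, which makes r and s points. Ranks increase strictly along every edge: the
-- lower-ranked root is linked below the higher one, and on equal ranks the new root receives
-- the successor rank. That successor exists because the injection i gives distinct roots
-- distinct ranks not below any used rank, so r and s cannot both sit at the largest rank;
-- composing i with a swap of two points then restores the injection for the new ranks.

open import Defs
open import Level using (Level)
open import Data.Product using (_×_; _,_; proj₁; proj₂; ∃)
open import Relation.Binary.PropositionalEquality as Eq using (_≡_; refl; cong; cong₂; sym; trans)
open import Relation.Binary.Bundles using (Poset)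
open import Relation.Nullary using (¬_)
open import Function using (_∘_)
open import Algebra.Lattice.Bundles using (BooleanAlgebra)
import Algebra.Lattice.Properties.BooleanAlgebra as BooleanAlgebraProperties
import Relation.Binary.Reasoning.PartialOrder as ⊑-Reasoning
open import Algebra.Lattice.Structures using (IsBooleanAlgebra)
open import Algebra.Structures using (IsIdempotentSemiring)
open import Data.Nat as ℕ using (ℕ; zero; suc; _+_)
import Data.Nat.Properties as ℕP
open import Data.Fin using (Fin; toℕ)
import Data.Fin.Properties as FinP
open import Data.List using (length; lookup)
open import Data.List.Relation.Unary.Any using (index)
open import Data.List.Relation.Unary.Any.Properties using (lookup-index)

module Properties {a} (K : KleeneRelationAlgebra a) where

  open KRA K renaming (_⊔ₛ_ to _⊔_; ⊥ₛ to ⊥; ⊤ₛ to ⊤)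

  private
    module BA = IsBooleanAlgebra isBooleanAlgebra
    module SR = IsIdempotentSemiring isIdempotentSemiring
    ⊔-⊓-booleanAlgebra : BooleanAlgebra a a
    ⊔-⊓-booleanAlgebra = record { isBooleanAlgebra = isBooleanAlgebra }
    module BAP = BooleanAlgebraProperties ⊔-⊓-booleanAlgebra

  ⊔-comm : ∀ x y → x ⊔ y ≡ y ⊔ x
  ⊔-comm = BA.∨-comm
  ⊔-assoc : ∀ x y z → (x ⊔ y) ⊔ z ≡ x ⊔ (y ⊔ z)
  ⊔-assoc = BA.∨-assoc
  ⊔-idem : ∀ x → x ⊔ x ≡ x
  ⊔-idem = SR.+-idem
  ⊔-identityˡ : ∀ x → ⊥ ⊔ x ≡ x
  ⊔-identityˡ = proj₁ SR.+-identity
  ⊔-identityʳ : ∀ x → x ⊔ ⊥ ≡ x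
  ⊔-identityʳ = proj₂ SR.+-identity
  ⊔-zeroʳ : ∀ x → x ⊔ ⊤ ≡ ⊤
  ⊔-zeroʳ = BAP.∨-zeroʳ
  ⊓-comm : ∀ x y → x ⊓ y ≡ y ⊓ x
  ⊓-comm = BA.∧-comm
  ⊓-assoc : ∀ x y z → (x ⊓ y) ⊓ z ≡ x ⊓ (y ⊓ z)
  ⊓-assoc = BA.∧-assoc
  ⊓-idem : ∀ x → x ⊓ x ≡ x
  ⊓-idem = BAP.∧-idem
  ⊓-identityˡ : ∀ x → ⊤ ⊓ x ≡ x
  ⊓-identityˡ = BAP.∧-identityˡ
  ⊓-identityʳ : ∀ x → x ⊓ ⊤ ≡ x
  ⊓-identityʳ = BAP.∧-identityʳ
  ⊔-absorbs-⊓ : ∀ x y → x ⊔ (x ⊓ y) ≡ x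
  ⊔-absorbs-⊓ = BA.∨-absorbs-∧
  ⊓-absorbs-⊔ : ∀ x y → x ⊓ (x ⊔ y) ≡ x
  ⊓-absorbs-⊔ = BA.∧-absorbs-∨
  ⊓-distribˡ-⊔ : ∀ x y z → x ⊓ (y ⊔ z) ≡ (x ⊓ y) ⊔ (x ⊓ z)
  ⊓-distribˡ-⊔ = BA.∧-distribˡ-∨
  ⊓-distribʳ-⊔ : ∀ x y z → (y ⊔ z) ⊓ x ≡ (y ⊓ x) ⊔ (z ⊓ x)
  ⊓-distribʳ-⊔ = BA.∧-distribʳ-∨
  ⊔-complementʳ : ∀ x → x ⊔ ‾ x ≡ ⊤
  ⊔-complementʳ = BA.∨-complementʳ
  ⊓-complementʳ : ∀ x → x ⊓ ‾ x ≡ ⊥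
  ⊓-complementʳ = BA.∧-complementʳ
  ⊓-complementˡ : ∀ x → ‾ x ⊓ x ≡ ⊥
  ⊓-complementˡ = BA.∧-complementˡ
  ‾-involutive : ∀ x → ‾ (‾ x) ≡ x
  ‾-involutive = BAP.¬-involutive
  ‾-⊔ : ∀ x y → ‾ (x ⊔ y) ≡ ‾ x ⊓ ‾ y
  ‾-⊔ = BAP.deMorgan₂

  ·-assoc : ∀ x y z → (x · y) · z ≡ x · (y · z)
  ·-assoc = SR.*-assoc
  ·-identityˡ : ∀ x → 𝟙 · x ≡ x
  ·-identityˡ = proj₁ SR.*-identity
  ·-identityʳ : ∀ x → x · 𝟙 ≡ x
  ·-identityʳ = proj₂ SR.*-identity
  ·-distribˡ-⊔ : ∀ x y z → x · (y ⊔ z) ≡ (x · y) ⊔ (x · z)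
  ·-distribˡ-⊔ = proj₁ SR.distrib
  ·-distribʳ-⊔ : ∀ x y z → (y ⊔ z) · x ≡ (y · x) ⊔ (z · x)
  ·-distribʳ-⊔ = proj₂ SR.distrib
  ·-zeroˡ : ∀ x → ⊥ · x ≡ ⊥
  ·-zeroˡ = proj₁ SR.zero
  ·-zeroʳ : ∀ x → x · ⊥ ≡ ⊥
  ·-zeroʳ = proj₂ SR.zero

  ⊑-refl : ∀ {x} → x ⊑ x
  ⊑-refl {x} = ⊔-idem x

  ⊑-reflexive : ∀ {x y} → x ≡ y → x ⊑ y
  ⊑-reflexive refl = ⊑-refl

  ⊑-trans : ∀ {x y z} → x ⊑ y → y ⊑ z → x ⊑ z
  ⊑-trans {x} {y} {z} x⊑y y⊑z =
    trans (cong (x ⊔_) (sym y⊑z)) (trans (sym (⊔-assoc x y z)) (trans (cong (_⊔ z) x⊑y) y⊑z))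

  ⊑-antisym : ∀ {x y} → x ⊑ y → y ⊑ x → x ≡ y
  ⊑-antisym {x} {y} x⊑y y⊑x = trans (sym y⊑x) (trans (⊔-comm y x) x⊑y)

  ⊑-poset : Poset a a a
  ⊑-poset = record
    { Carrier = S ; _≈_ = _≡_ ; _≤_ = _⊑_
    ; isPartialOrder = record
       { isPreorder = record { isEquivalence = Eq.isEquivalence
                             ; reflexive = ⊑-reflexive ; trans = ⊑-trans }
       ; antisym = ⊑-antisym } }

  open ⊑-Reasoning ⊑-poset using (begin_; _∎; begin-equality_; step-≡-⟩; step-≤)

  ⊥-least : ∀ {x} → ⊥ ⊑ x
  ⊥-least {x} = ⊔-identityˡ x

  ⊤-greatest : ∀ {x} → x ⊑ ⊤
  ⊤-greatest {x} = ⊔-zeroʳ x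

  ⊑⊥⇒≡⊥ : ∀ {x} → x ⊑ ⊥ → x ≡ ⊥
  ⊑⊥⇒≡⊥ x⊑⊥ = ⊑-antisym x⊑⊥ ⊥-least

  ≡⊥⇒⊑ : ∀ {x y} → x ≡ ⊥ → x ⊑ y
  ≡⊥⇒⊑ refl = ⊥-least

  ⊔-upperˡ : ∀ {x y} → x ⊑ x ⊔ y
  ⊔-upperˡ {x} {y} = trans (sym (⊔-assoc x x y)) (cong (_⊔ y) (⊔-idem x))

  ⊔-upperʳ : ∀ {x y} → y ⊑ x ⊔ y
  ⊔-upperʳ {x} {y} = ⊑-trans (⊔-upperˡ {y} {x}) (⊑-reflexive (⊔-comm y x))

  ⊔-lub : ∀ {x y z} → x ⊑ z → y ⊑ z → x ⊔ y ⊑ z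
  ⊔-lub {x} {y} {z} x⊑z y⊑z = trans (⊔-assoc x y z) (trans (cong (x ⊔_) y⊑z) x⊑z)

  ⊑⇒⊓ : ∀ {x y} → x ⊑ y → x ⊓ y ≡ x
  ⊑⇒⊓ {x} {y} x⊑y = trans (cong (x ⊓_) (sym x⊑y)) (⊓-absorbs-⊔ x y)

  ⊓⇒⊑ : ∀ {x y} → x ⊓ y ≡ x → x ⊑ y
  ⊓⇒⊑ {x} {y} x⊓y≡x = trans (cong (_⊔ y) (sym x⊓y≡x))
    (trans (⊔-comm (x ⊓ y) y) (trans (cong (y ⊔_) (⊓-comm x y)) (⊔-absorbs-⊓ y x)))

  ⊓-lowerˡ : ∀ {x y} → x ⊓ y ⊑ x
  ⊓-lowerˡ {x} {y} = ⊓⇒⊑ (trans (⊓-comm (x ⊓ y) x)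
    (trans (sym (⊓-assoc x x y)) (cong (_⊓ y) (⊓-idem x))))

  ⊓-lowerʳ : ∀ {x y} → x ⊓ y ⊑ y
  ⊓-lowerʳ {x} {y} = trans (cong (_⊔ y) (⊓-comm x y)) (⊓-lowerˡ {y} {x})

  ⊓-glb : ∀ {x y z} → z ⊑ x → z ⊑ y → z ⊑ x ⊓ y
  ⊓-glb {x} {y} {z} z⊑x z⊑y = ⊓⇒⊑ (trans (sym (⊓-assoc z x y))
    (trans (cong (_⊓ y) (⊑⇒⊓ z⊑x)) (⊑⇒⊓ z⊑y)))

  ⊔-mono : ∀ {x x′ y y′} → x ⊑ x′ → y ⊑ y′ → x ⊔ y ⊑ x′ ⊔ y′
  ⊔-mono x⊑x′ y⊑y′ = ⊔-lub (⊑-trans x⊑x′ ⊔-upperˡ) (⊑-trans y⊑y′ ⊔-upperʳ)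

  ⊓-mono : ∀ {x x′ y y′} → x ⊑ x′ → y ⊑ y′ → x ⊓ y ⊑ x′ ⊓ y′
  ⊓-mono x⊑x′ y⊑y′ = ⊓-glb (⊑-trans ⊓-lowerˡ x⊑x′) (⊑-trans ⊓-lowerʳ y⊑y′)

  ·-monoˡ : ∀ {x x′} y → x ⊑ x′ → x · y ⊑ x′ · y
  ·-monoˡ {x} {x′} y x⊑x′ = trans (sym (·-distribʳ-⊔ y x x′)) (cong (_· y) x⊑x′)

  ·-monoʳ : ∀ x {y y′} → y ⊑ y′ → x · y ⊑ x · y′
  ·-monoʳ x {y} {y′} y⊑y′ = trans (sym (·-distribˡ-⊔ x y y′)) (cong (x ·_) y⊑y′)

  ·-mono : ∀ {x x′ y y′} → x ⊑ x′ → y ⊑ y′ → x · y ⊑ x′ · y′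
  ·-mono {x′ = x′} {y = y} x⊑x′ y⊑y′ = ⊑-trans (·-monoˡ y x⊑x′) (·-monoʳ x′ y⊑y′)

  ⊓-split : ∀ x y → x ≡ (x ⊓ y) ⊔ (x ⊓ ‾ y)
  ⊓-split x y = sym (begin-equality
    (x ⊓ y) ⊔ (x ⊓ ‾ y)    ≡⟨ sym (⊓-distribˡ-⊔ x y (‾ y)) ⟩
    x ⊓ (y ⊔ ‾ y)          ≡⟨ cong (x ⊓_) (⊔-complementʳ y) ⟩
    x ⊓ ⊤                  ≡⟨ ⊓-identityʳ x ⟩
    x                      ∎)

  ⊑⇒⊓‾ : ∀ {x y} → x ⊑ y → x ⊓ ‾ y ≡ ⊥
  ⊑⇒⊓‾ {x} {y} x⊑y = ⊑⊥⇒≡⊥ (⊑-trans (⊓-mono x⊑y ⊑-refl) (⊑-reflexive (⊓-complementʳ y)))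

  ⊓‾⇒⊑ : ∀ {x y} → x ⊓ ‾ y ≡ ⊥ → x ⊑ y
  ⊓‾⇒⊑ {x} {y} x⊓‾y≡⊥ = ⊓⇒⊑ (begin-equality
    x ⊓ y                  ≡⟨ sym (⊔-identityʳ _) ⟩
    (x ⊓ y) ⊔ ⊥            ≡⟨ cong ((x ⊓ y) ⊔_) (sym x⊓‾y≡⊥) ⟩
    (x ⊓ y) ⊔ (x ⊓ ‾ y)    ≡⟨ sym (⊓-split x y) ⟩
    x                      ∎)

  disjoint⇒⊑‾ : ∀ {x y} → x ⊓ y ≡ ⊥ → x ⊑ ‾ y
  disjoint⇒⊑‾ {x} {y} x⊓y≡⊥ = ⊓‾⇒⊑ (trans (cong (x ⊓_) (‾-involutive y)) x⊓y≡⊥)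

  ⊑‾⇒disjoint : ∀ {x y} → x ⊑ ‾ y → x ⊓ y ≡ ⊥
  ⊑‾⇒disjoint {x} {y} x⊑‾y = trans (cong (x ⊓_) (sym (‾-involutive y))) (⊑⇒⊓‾ x⊑‾y)

  shunting : ∀ {x y z} → x ⊑ ‾ y ⊔ z → x ⊓ y ⊑ z
  shunting {x} {y} {z} x⊑‾y⊔z = begin
    x ⊓ y                      ≤⟨ ⊓-mono x⊑‾y⊔z ⊑-refl ⟩
    (‾ y ⊔ z) ⊓ y              ≡⟨ ⊓-distribʳ-⊔ y (‾ y) z ⟩
    (‾ y ⊓ y) ⊔ (z ⊓ y)        ≡⟨ cong (_⊔ (z ⊓ y)) (⊓-complementˡ y) ⟩
    ⊥ ⊔ (z ⊓ y)                ≡⟨ ⊔-identityˡ _ ⟩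
    z ⊓ y                      ≤⟨ ⊓-lowerˡ ⟩
    z                          ∎

  ‾-antitone : ∀ {x y} → x ⊑ y → ‾ y ⊑ ‾ x
  ‾-antitone {x} {y} x⊑y = disjoint⇒⊑‾ (⊑⊥⇒≡⊥ (begin
    ‾ y ⊓ x                    ≤⟨ ⊓-mono ⊑-refl x⊑y ⟩
    ‾ y ⊓ y                    ≡⟨ ⊓-complementˡ y ⟩
    ⊥                          ∎))

  ⊑⊔-disjoint : ∀ {x y z} → x ⊑ y ⊔ z → x ⊓ z ≡ ⊥ → x ⊑ y
  ⊑⊔-disjoint {x} {y} {z} x⊑y⊔z x⊓z≡⊥ = begin
    x                          ≡⟨ sym (⊑⇒⊓ x⊑y⊔z) ⟩
    x ⊓ (y ⊔ z)                ≡⟨ ⊓-distribˡ-⊔ x y z ⟩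
    (x ⊓ y) ⊔ (x ⊓ z)          ≡⟨ cong ((x ⊓ y) ⊔_) x⊓z≡⊥ ⟩
    (x ⊓ y) ⊔ ⊥                ≡⟨ ⊔-identityʳ _ ⟩
    x ⊓ y                      ≤⟨ ⊓-lowerʳ ⟩
    y                          ∎

  ᵀ-mono : ∀ {x y} → x ⊑ y → x ᵀ ⊑ y ᵀ
  ᵀ-mono {x} {y} p = trans (sym (ᵀ-⊔ x y)) (cong _ᵀ p)

  ᵀ-reflects-⊑ : ∀ {x y} → x ᵀ ⊑ y ᵀ → x ⊑ y
  ᵀ-reflects-⊑ {x} {y} p = Eq.subst₂ _⊑_ (ᵀ-invol x) (ᵀ-invol y) (ᵀ-mono p)

  ⊑ᵀ⇒ᵀ⊑ : ∀ {x y} → x ⊑ y ᵀ → x ᵀ ⊑ y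
  ⊑ᵀ⇒ᵀ⊑ {x} {y} p = Eq.subst (x ᵀ ⊑_) (ᵀ-invol y) (ᵀ-mono p)

  ᵀ⊑⇒⊑ᵀ : ∀ {x y} → x ᵀ ⊑ y → x ⊑ y ᵀ
  ᵀ⊑⇒⊑ᵀ {x} {y} p = Eq.subst (_⊑ y ᵀ) (ᵀ-invol x) (ᵀ-mono p)

  ⊤ᵀ : ⊤ ᵀ ≡ ⊤
  ⊤ᵀ = ⊑-antisym ⊤-greatest (ᵀ⊑⇒⊑ᵀ ⊤-greatest)

  ⊥ᵀ : ⊥ ᵀ ≡ ⊥
  ⊥ᵀ = ⊑-antisym (⊑ᵀ⇒ᵀ⊑ ⊥-least) ⊥-least

  𝟙ᵀ : 𝟙 ᵀ ≡ 𝟙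
  𝟙ᵀ = begin-equality
      𝟙 ᵀ                ≡⟨ sym (·-identityʳ (𝟙 ᵀ)) ⟩
      𝟙 ᵀ · 𝟙            ≡⟨ cong (𝟙 ᵀ ·_) (sym (ᵀ-invol 𝟙)) ⟩
      𝟙 ᵀ · (𝟙 ᵀ) ᵀ      ≡⟨ sym (ᵀ-· (𝟙 ᵀ) 𝟙) ⟩
      (𝟙 ᵀ · 𝟙) ᵀ        ≡⟨ cong _ᵀ (·-identityʳ (𝟙 ᵀ)) ⟩
      (𝟙 ᵀ) ᵀ            ≡⟨ ᵀ-invol 𝟙 ⟩
      𝟙 ∎

  ·ᵀ-ᵀ : ∀ x y → (x · y ᵀ) ᵀ ≡ y · x ᵀ
  ·ᵀ-ᵀ x y = trans (ᵀ-· x (y ᵀ)) (cong (_· x ᵀ) (ᵀ-invol y))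

  ᵀ-⊓ : ∀ x y → (x ⊓ y) ᵀ ≡ x ᵀ ⊓ y ᵀ
  ᵀ-⊓ x y = ⊑-antisym (⊓-glb (ᵀ-mono ⊓-lowerˡ) (ᵀ-mono ⊓-lowerʳ))
    (ᵀ⊑⇒⊑ᵀ (⊑-trans (ᵀ-mono ⊑-refl) (Eq.subst₂ (λ u v → (x ᵀ ⊓ y ᵀ) ᵀ ⊑ u ⊓ v) (ᵀ-invol x) (ᵀ-invol y)
       (⊓-glb (ᵀ-mono ⊓-lowerˡ) (ᵀ-mono ⊓-lowerʳ)))))

  dedekindʳ : ∀ x y z → (x · y) ⊓ z ⊑ (x ⊓ (z · y ᵀ)) · y
  dedekindʳ x y z = ᵀ-reflects-⊑ (begin
    ((x · y) ⊓ z) ᵀ                 ≡⟨ ᵀ-⊓ (x · y) z ⟩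
    (x · y) ᵀ ⊓ z ᵀ                 ≡⟨ cong (_⊓ z ᵀ) (ᵀ-· x y) ⟩
    (y ᵀ · x ᵀ) ⊓ z ᵀ               ≤⟨ dedekind (y ᵀ) (x ᵀ) (z ᵀ) ⟩
    y ᵀ · (x ᵀ ⊓ ((y ᵀ) ᵀ · z ᵀ))   ≡⟨ cong (λ u → y ᵀ · (x ᵀ ⊓ u)) (sym (ᵀ-· z (y ᵀ))) ⟩
    y ᵀ · (x ᵀ ⊓ (z · y ᵀ) ᵀ)       ≡⟨ cong (y ᵀ ·_) (sym (ᵀ-⊓ x (z · y ᵀ))) ⟩
    y ᵀ · (x ⊓ (z · y ᵀ)) ᵀ         ≡⟨ sym (ᵀ-· (x ⊓ (z · y ᵀ)) y) ⟩
    ((x ⊓ (z · y ᵀ)) · y) ᵀ ∎)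

  x⊑xxᵀx : ∀ x → x ⊑ x · x ᵀ · x
  x⊑xxᵀx x = begin
    x                       ≡⟨ sym (⊓-idem x) ⟩
    x ⊓ x                   ≡⟨ cong (_⊓ x) (sym (·-identityʳ x)) ⟩
    (x · 𝟙) ⊓ x             ≤⟨ dedekind x 𝟙 x ⟩
    x · (𝟙 ⊓ (x ᵀ · x))     ≤⟨ ·-monoʳ x ⊓-lowerʳ ⟩
    x · x ᵀ · x ∎

  coreflexive-ᵀ : ∀ {e} → e ⊑ 𝟙 → e ᵀ ≡ e
  coreflexive-ᵀ {e} p = ⊑-antisym eᵀ⊑e e⊑eᵀ
    where
    e⊑eᵀ : e ⊑ e ᵀ
    e⊑eᵀ = begin
      e                 ≤⟨ x⊑xxᵀx e ⟩
      e · e ᵀ · e       ≤⟨ ·-mono p (·-monoʳ (e ᵀ) p) ⟩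
      𝟙 · e ᵀ · 𝟙       ≡⟨ trans (·-identityˡ _) (·-identityʳ _) ⟩
      e ᵀ ∎
    eᵀ⊑e : e ᵀ ⊑ e
    eᵀ⊑e = Eq.subst (e ᵀ ⊑_) (ᵀ-invol e) (ᵀ-mono e⊑eᵀ)

  x⊑x·⊤ : ∀ {x} → x ⊑ x · ⊤
  x⊑x·⊤ {x} = ⊑-trans (⊑-reflexive (sym (·-identityʳ x))) (·-monoʳ x ⊤-greatest)

  x⊑⊤·x : ∀ {x} → x ⊑ ⊤ · x
  x⊑⊤·x {x} = ⊑-trans (⊑-reflexive (sym (·-identityˡ x))) (·-monoˡ x ⊤-greatest)

  ⊤·⊤≡⊤ : ⊤ · ⊤ ≡ ⊤
  ⊤·⊤≡⊤ = ⊑-antisym ⊤-greatest x⊑x·⊤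

  -- Vectors and points

  vec-⊓· : ∀ {v} → vector v → ∀ x y → (v ⊓ x) · y ≡ v ⊓ (x · y)
  vec-⊓· {v} vv x y = ⊑-antisym
    (⊓-glb (⊑-trans (·-monoˡ y ⊓-lowerˡ) (⊑-trans (·-monoʳ v ⊤-greatest) (⊑-reflexive vv))) (·-monoˡ y ⊓-lowerʳ))
    (begin
      v ⊓ (x · y)         ≡⟨ ⊓-comm v (x · y) ⟩
      (x · y) ⊓ v         ≤⟨ dedekindʳ x y v ⟩
      (x ⊓ (v · y ᵀ)) · y ≤⟨ ·-monoˡ y (⊓-mono ⊑-refl (⊑-trans (·-monoʳ v ⊤-greatest) (⊑-reflexive vv))) ⟩
      (x ⊓ v) · y         ≡⟨ cong (_· y) (⊓-comm x v) ⟩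
      (v ⊓ x) · y ∎)

  vec⊓𝟙· : ∀ {v} → vector v → ∀ x → (v ⊓ 𝟙) · x ≡ v ⊓ x
  vec⊓𝟙· vv x = trans (vec-⊓· vv 𝟙 x) (cong (_ ⊓_) (·-identityˡ x))

  vec⊓𝟙·⊤ : ∀ {v} → vector v → (v ⊓ 𝟙) · ⊤ ≡ v
  vec⊓𝟙·⊤ {v} vv = trans (vec⊓𝟙· vv ⊤) (⊓-identityʳ v)

  x·⊤-vec : ∀ x → vector (x · ⊤)
  x·⊤-vec x = trans (·-assoc x ⊤ ⊤) (cong (x ·_) ⊤·⊤≡⊤)

  ·-vec : ∀ x {v} → vector v → vector (x · v)
  ·-vec x {v} vv = trans (·-assoc x v ⊤) (cong (x ·_) vv)

  vec-⊓ : ∀ {v w} → vector v → vector w → vector (v ⊓ w)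
  vec-⊓ {v} {w} vv vw = trans (vec-⊓· vv w ⊤) (cong (v ⊓_) vw)

  vec-‾ : ∀ {v} → vector v → vector (‾ v)
  vec-‾ {v} vv = ⊑-antisym
    (disjoint⇒⊑‾ (⊑⊥⇒≡⊥ (begin
       (‾ v · ⊤) ⊓ v          ≤⟨ dedekindʳ (‾ v) ⊤ v ⟩
       (‾ v ⊓ (v · ⊤ ᵀ)) · ⊤  ≡⟨ cong (λ u → (‾ v ⊓ (v · u)) · ⊤) ⊤ᵀ ⟩
       (‾ v ⊓ (v · ⊤)) · ⊤    ≡⟨ cong (λ u → (‾ v ⊓ u) · ⊤) vv ⟩
       (‾ v ⊓ v) · ⊤          ≡⟨ cong (_· ⊤) (⊓-complementˡ v) ⟩
       ⊥ · ⊤                  ≡⟨ ·-zeroˡ ⊤ ⟩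
       ⊥ ∎)))
    x⊑x·⊤

  vec-·ᵀ⊑ : ∀ {v} → vector v → v · v ᵀ ⊑ v
  vec-·ᵀ⊑ {v} vv = ⊑-trans (·-monoʳ v ⊤-greatest) (⊑-reflexive vv)

  vecᵀ≡⊤·vecᵀ : ∀ {v} → vector v → v ᵀ ≡ ⊤ · v ᵀ
  vecᵀ≡⊤·vecᵀ {v} vv = trans (cong _ᵀ (sym vv)) (trans (ᵀ-· v ⊤) (cong (_· v ᵀ) ⊤ᵀ))

  ⊓𝟙-ᵀ : ∀ x → (x ⊓ 𝟙) ᵀ ≡ x ⊓ 𝟙
  ⊓𝟙-ᵀ _ = coreflexive-ᵀ ⊓-lowerʳ

  ᵀ⊓𝟙 : ∀ x → x ᵀ ⊓ 𝟙 ≡ x ⊓ 𝟙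
  ᵀ⊓𝟙 x = trans (cong (x ᵀ ⊓_) (sym 𝟙ᵀ)) (trans (sym (ᵀ-⊓ x 𝟙)) (⊓𝟙-ᵀ x))

  ⊓vecᵀ : ∀ {v} → vector v → ∀ x → x ⊓ v ᵀ ≡ x · (v ⊓ 𝟙)
  ⊓vecᵀ {v} vv x = begin-equality
    x ⊓ v ᵀ                        ≡⟨ sym (ᵀ-invol _) ⟩
    ((x ⊓ v ᵀ) ᵀ) ᵀ                ≡⟨ cong _ᵀ (ᵀ-⊓ x (v ᵀ)) ⟩
    (x ᵀ ⊓ (v ᵀ) ᵀ) ᵀ              ≡⟨ cong (λ u → (x ᵀ ⊓ u) ᵀ) (ᵀ-invol v) ⟩
    (x ᵀ ⊓ v) ᵀ                    ≡⟨ cong _ᵀ (⊓-comm (x ᵀ) v) ⟩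
    (v ⊓ x ᵀ) ᵀ                    ≡⟨ cong _ᵀ (sym (vec⊓𝟙· vv (x ᵀ))) ⟩
    ((v ⊓ 𝟙) · x ᵀ) ᵀ              ≡⟨ ᵀ-· (v ⊓ 𝟙) (x ᵀ) ⟩
    (x ᵀ) ᵀ · (v ⊓ 𝟙) ᵀ            ≡⟨ cong₂ _·_ (ᵀ-invol x) (⊓𝟙-ᵀ _) ⟩
    x · (v ⊓ 𝟙) ∎

  vec-⊓-vecᵀ : ∀ {v w} → vector v → vector w → v ⊓ w ᵀ ≡ v · w ᵀ
  vec-⊓-vecᵀ {v} {w} vv vw = begin-equality
    v ⊓ w ᵀ                ≡⟨ cong (v ⊓_) (vecᵀ≡⊤·vecᵀ vw) ⟩
    v ⊓ (⊤ · w ᵀ)          ≡⟨ sym (vec⊓𝟙· vv (⊤ · w ᵀ)) ⟩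
    (v ⊓ 𝟙) · (⊤ · w ᵀ)    ≡⟨ sym (·-assoc _ _ _) ⟩
    ((v ⊓ 𝟙) · ⊤) · w ᵀ    ≡⟨ cong (_· w ᵀ) (vec⊓𝟙·⊤ vv) ⟩
    v · w ᵀ ∎

  vecᵀ·vec : ∀ {v} → vector v → ∀ w → v ᵀ · w ≡ ⊤ · (v ⊓ w)
  vecᵀ·vec {v} vv w = begin-equality
    v ᵀ · w                        ≡⟨ cong (λ u → u ᵀ · w) (sym (vec⊓𝟙·⊤ vv)) ⟩
    ((v ⊓ 𝟙) · ⊤) ᵀ · w            ≡⟨ cong (_· w) (ᵀ-· (v ⊓ 𝟙) ⊤) ⟩
    (⊤ ᵀ · (v ⊓ 𝟙) ᵀ) · w          ≡⟨ cong₂ (λ u t → (u · t) · w) ⊤ᵀ (⊓𝟙-ᵀ _) ⟩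
    (⊤ · (v ⊓ 𝟙)) · w              ≡⟨ ·-assoc _ _ _ ⟩
    ⊤ · ((v ⊓ 𝟙) · w)              ≡⟨ cong (⊤ ·_) (vec⊓𝟙· vv w) ⟩
    ⊤ · (v ⊓ w) ∎

  vecᵀ·disjoint : ∀ {v w} → vector v → vector w → v ⊓ w ≡ ⊥ → ∀ X → v ᵀ · (w ⊓ X) ≡ ⊥
  vecᵀ·disjoint {v} {w} vv vw d X = begin-equality
    v ᵀ · (w ⊓ X)              ≡⟨ cong (v ᵀ ·_) (sym (vec⊓𝟙· vw X)) ⟩
    v ᵀ · ((w ⊓ 𝟙) · X)        ≡⟨ sym (·-assoc _ _ _) ⟩
    (v ᵀ · (w ⊓ 𝟙)) · X        ≡⟨ cong (λ u → (v ᵀ · u) · X) (sym (⊓𝟙-ᵀ _)) ⟩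
    (v ᵀ · (w ⊓ 𝟙) ᵀ) · X      ≡⟨ cong (_· X) (sym (ᵀ-· (w ⊓ 𝟙) v)) ⟩
    ((w ⊓ 𝟙) · v) ᵀ · X        ≡⟨ cong (λ u → u ᵀ · X) (vec⊓𝟙· vw v) ⟩
    (w ⊓ v) ᵀ · X              ≡⟨ cong (λ u → u ᵀ · X) (trans (⊓-comm w v) d) ⟩
    ⊥ ᵀ · X                    ≡⟨ cong (_· X) ⊥ᵀ ⟩
    ⊥ · X                      ≡⟨ ·-zeroˡ X ⟩
    ⊥ ∎

  total⇒·⊤≡⊤ : ∀ {x} → total x → x · ⊤ ≡ ⊤
  total⇒·⊤≡⊤ {x} t = ⊑-antisym ⊤-greatest (begin
    ⊤                ≡⟨ sym (·-identityˡ ⊤) ⟩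
    𝟙 · ⊤            ≤⟨ ·-monoˡ ⊤ t ⟩
    (x · x ᵀ) · ⊤    ≡⟨ ·-assoc _ _ _ ⟩
    x · (x ᵀ · ⊤)    ≤⟨ ·-monoʳ x ⊤-greatest ⟩
    x · ⊤ ∎)

  ·⊤≡⊤⇒total : ∀ {x} → x · ⊤ ≡ ⊤ → total x
  ·⊤≡⊤⇒total {x} e = begin
    𝟙                       ≡⟨ sym (⊓-identityˡ 𝟙) ⟩
    ⊤ ⊓ 𝟙                   ≡⟨ cong (_⊓ 𝟙) (sym e) ⟩
    (x · ⊤) ⊓ 𝟙             ≤⟨ dedekind x ⊤ 𝟙 ⟩
    x · (⊤ ⊓ (x ᵀ · 𝟙))     ≡⟨ cong (x ·_) (trans (⊓-identityˡ _) (·-identityʳ _)) ⟩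
    x · x ᵀ ∎

  surjective⇒⊤·≡⊤ : ∀ {x} → surjective x → ⊤ · x ≡ ⊤
  surjective⇒⊤·≡⊤ {x} s = ⊑-antisym ⊤-greatest (begin
    ⊤                ≡⟨ sym (·-identityʳ ⊤) ⟩
    ⊤ · 𝟙            ≤⟨ ·-monoʳ ⊤ s ⟩
    ⊤ · (x ᵀ · x)    ≡⟨ sym (·-assoc _ _ _) ⟩
    (⊤ · x ᵀ) · x    ≤⟨ ·-monoˡ x ⊤-greatest ⟩
    ⊤ · x ∎)

  ⊤·≡⊤⇒surjective : ∀ {x} → ⊤ · x ≡ ⊤ → surjective x
  ⊤·≡⊤⇒surjective {x} e = begin
    𝟙                       ≡⟨ sym (⊓-identityˡ 𝟙) ⟩
    ⊤ ⊓ 𝟙                   ≡⟨ cong (_⊓ 𝟙) (sym xᵀ⊤) ⟩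
    (x ᵀ · ⊤) ⊓ 𝟙           ≤⟨ dedekind (x ᵀ) ⊤ 𝟙 ⟩
    x ᵀ · (⊤ ⊓ ((x ᵀ) ᵀ · 𝟙)) ≡⟨ cong (x ᵀ ·_) (trans (⊓-identityˡ _) (trans (·-identityʳ _) (ᵀ-invol x))) ⟩
    x ᵀ · x ∎
    where
    xᵀ⊤ : x ᵀ · ⊤ ≡ ⊤
    xᵀ⊤ = trans (cong (x ᵀ ·_) (sym ⊤ᵀ)) (trans (sym (ᵀ-· ⊤ x)) (trans (cong _ᵀ e) ⊤ᵀ))

  surjective⇒ᵀ·⊤≡⊤ : ∀ {x} → surjective x → x ᵀ · ⊤ ≡ ⊤
  surjective⇒ᵀ·⊤≡⊤ {x} s = trans (cong (x ᵀ ·_) (sym ⊤ᵀ)) (trans (sym (ᵀ-· ⊤ x)) (trans (cong _ᵀ (surjective⇒⊤·≡⊤ s)) ⊤ᵀ))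

  module _ {p : S} (pp : point p) where
    pt-vec : vector p
    pt-vec = proj₁ pp
    pt-inj : injective p
    pt-inj = proj₁ (proj₂ pp)
    pt-surj : surjective p
    pt-surj = proj₂ (proj₂ pp)

    pt-⊤ : ⊤ · p ≡ ⊤
    pt-⊤ = surjective⇒⊤·≡⊤ pt-surj

    ptᵀ⊤ : p ᵀ · ⊤ ≡ ⊤
    ptᵀ⊤ = surjective⇒ᵀ·⊤≡⊤ pt-surj

    ptᵀpt : p ᵀ · p ≡ ⊤
    ptᵀpt = ⊑-antisym ⊤-greatest (begin
      ⊤              ≡⟨ sym (·-identityʳ ⊤) ⟩
      ⊤ · 𝟙          ≤⟨ ·-monoʳ ⊤ pt-surj ⟩
      ⊤ · (p ᵀ · p)  ≡⟨ sym (·-assoc _ _ _) ⟩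
      (⊤ · p ᵀ) · p  ≡⟨ cong (_· p) (sym (vecᵀ≡⊤·vecᵀ pt-vec)) ⟩
      p ᵀ · p ∎)

    pt-atom : ∀ {v} → vector v → ⊤ · (p ⊓ v) ≡ ⊤ → p ⊑ v
    pt-atom {v} vv e = ⊓‾⇒⊑ (begin-eq)
      where
      u = p ⊓ ‾ v
      w = p ⊓ v
      vu : vector u
      vu = vec-⊓ pt-vec (vec-‾ vv)
      vw : vector w
      vw = vec-⊓ pt-vec vv
      uw1 : u · w ᵀ ⊑ 𝟙
      uw1 = ⊑-trans (·-mono ⊓-lowerˡ (ᵀ-mono ⊓-lowerˡ)) pt-inj
      uw : u · w ᵀ ≡ ⊥
      uw = ⊑⊥⇒≡⊥ (begin
           u · w ᵀ                 ≤⟨ ⊓-glb ⊑-refl uw1 ⟩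
           (u · w ᵀ) ⊓ 𝟙           ≡⟨ cong (_⊓ 𝟙) (sym (vec-⊓-vecᵀ vu vw)) ⟩
           (u ⊓ w ᵀ) ⊓ 𝟙           ≡⟨ ⊓-assoc _ _ _ ⟩
           u ⊓ (w ᵀ ⊓ 𝟙)           ≡⟨ cong (u ⊓_) (ᵀ⊓𝟙 _) ⟩
           u ⊓ (w ⊓ 𝟙)             ≤⟨ ⊓-mono ⊓-lowerʳ ⊓-lowerˡ ⟩
           ‾ v ⊓ w                 ≤⟨ ⊓-mono ⊑-refl ⊓-lowerʳ ⟩
           ‾ v ⊓ v                 ≡⟨ ⊓-complementˡ v ⟩
           ⊥ ∎)
      wᵀ⊤ : w ᵀ · ⊤ ≡ ⊤
      wᵀ⊤ = trans (cong (w ᵀ ·_) (sym ⊤ᵀ)) (trans (sym (ᵀ-· ⊤ w)) (trans (cong _ᵀ e) ⊤ᵀ))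
      begin-eq : u ≡ ⊥
      begin-eq = begin-equality
        u                  ≡⟨ sym vu ⟩
        u · ⊤              ≡⟨ cong (u ·_) (sym wᵀ⊤) ⟩
        u · (w ᵀ · ⊤)      ≡⟨ sym (·-assoc _ _ _) ⟩
        (u · w ᵀ) · ⊤      ≡⟨ cong (_· ⊤) uw ⟩
        ⊥ · ⊤              ≡⟨ ·-zeroˡ ⊤ ⟩
        ⊥ ∎

    pt-meets⇒⊑ : TarskiRule → ∀ {v} → vector v → ¬ (p ⊓ v ≡ ⊥) → p ⊑ v
    pt-meets⇒⊑ T {v} vv ne = pt-atom vv (trans (sym (cong (⊤ ·_) (vec-⊓ pt-vec vv))) (trans (sym (·-assoc _ _ _)) (T (p ⊓ v) ne)))

  module _ {p q : S} (pp : point p) (pq : point q) where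
    pt-⊑⇒≡ : p ⊑ q → p ≡ q
    pt-⊑⇒≡ le = ⊑-antisym le (pt-atom pq (pt-vec pp) (trans (cong (⊤ ·_) (trans (⊓-comm q p) (⊑⇒⊓ le))) (pt-⊤ pp)))

    pt-dual : ∀ R → p ⊑ R · q → q ⊑ R ᵀ · p
    pt-dual R le = begin
      q                  ≡⟨ sym (·-identityʳ q) ⟩
      q · 𝟙              ≤⟨ ·-monoʳ q (pt-surj pp) ⟩
      q · (p ᵀ · p)      ≡⟨ sym (·-assoc _ _ _) ⟩
      (q · p ᵀ) · p      ≤⟨ ·-monoˡ p (·-monoʳ q (ᵀ-mono le)) ⟩
      (q · (R · q) ᵀ) · p ≡⟨ cong (λ u → (q · u) · p) (ᵀ-· R q) ⟩
      (q · (q ᵀ · R ᵀ)) · p ≡⟨ cong (_· p) (sym (·-assoc _ _ _)) ⟩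
      ((q · q ᵀ) · R ᵀ) · p ≤⟨ ·-monoˡ p (·-monoˡ (R ᵀ) (pt-inj pq)) ⟩
      (𝟙 · R ᵀ) · p       ≡⟨ cong (_· p) (·-identityˡ _) ⟩
      R ᵀ · p ∎

    pt-⊑-under-injective : ∀ {v} → injective v → p ⊑ v → q ⊑ v → p ⊑ q
    pt-⊑-under-injective {v} iv lp lq = begin
      p                    ≡⟨ sym (pt-vec pp) ⟩
      p · ⊤                ≡⟨ cong (p ·_) (sym (ptᵀpt pq)) ⟩
      p · (q ᵀ · q)        ≡⟨ sym (·-assoc _ _ _) ⟩
      (p · q ᵀ) · q        ≤⟨ ·-monoˡ q (·-mono lp (ᵀ-mono lq)) ⟩
      (v · v ᵀ) · q        ≤⟨ ·-monoˡ q iv ⟩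
      𝟙 · q                ≡⟨ ·-identityˡ q ⟩
      q ∎

  injective-· : ∀ {x y} → injective x → injective y → injective (x · y)
  injective-· {x} {y} ix iy = begin
    (x · y) · (x · y) ᵀ      ≡⟨ cong ((x · y) ·_) (ᵀ-· x y) ⟩
    (x · y) · (y ᵀ · x ᵀ)    ≡⟨ trans (·-assoc _ _ _) (cong (x ·_) (sym (·-assoc _ _ _))) ⟩
    x · ((y · y ᵀ) · x ᵀ)    ≤⟨ ·-monoʳ x (·-monoˡ (x ᵀ) iy) ⟩
    x · (𝟙 · x ᵀ)            ≡⟨ cong (x ·_) (·-identityˡ _) ⟩
    x · x ᵀ                  ≤⟨ ix ⟩
    𝟙                        ∎

  univalent-· : ∀ {x y} → univalent x → univalent y → univalent (x · y)
  univalent-· {x} {y} ux uy = begin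
    (x · y) ᵀ · (x · y)      ≡⟨ cong (_· (x · y)) (ᵀ-· x y) ⟩
    (y ᵀ · x ᵀ) · (x · y)    ≡⟨ trans (·-assoc _ _ _) (cong (y ᵀ ·_) (sym (·-assoc _ _ _))) ⟩
    y ᵀ · ((x ᵀ · x) · y)    ≤⟨ ·-monoʳ (y ᵀ) (·-monoˡ y ux) ⟩
    y ᵀ · (𝟙 · y)            ≡⟨ cong (y ᵀ ·_) (·-identityˡ _) ⟩
    y ᵀ · y                  ≤⟨ uy ⟩
    𝟙                        ∎

  univalent⇒ᵀ-injective : ∀ {x} → univalent x → injective (x ᵀ)
  univalent⇒ᵀ-injective {x} ux = ⊑-trans (⊑-reflexive (cong (x ᵀ ·_) (ᵀ-invol x))) ux

  univalent-image-pt : ∀ {f x} → univalent f → point x → x ⊑ f · ⊤ → point (f ᵀ · x)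
  univalent-image-pt {f} {x} uf px x⊑f⊤ =
    ·-vec (f ᵀ) (pt-vec px) , injective-· (univalent⇒ᵀ-injective uf) (pt-inj px) , ⊤·≡⊤⇒surjective ⊤·fᵀx≡⊤
    where
    ⊤·fᵀx≡⊤ : ⊤ · (f ᵀ · x) ≡ ⊤
    ⊤·fᵀx≡⊤ = ⊑-antisym ⊤-greatest (begin
      ⊤                   ≡⟨ sym (ptᵀpt px) ⟩
      x ᵀ · x             ≤⟨ ·-monoˡ x (ᵀ-mono x⊑f⊤) ⟩
      (f · ⊤) ᵀ · x       ≡⟨ cong (_· x) (trans (ᵀ-· f ⊤) (cong (_· f ᵀ) ⊤ᵀ)) ⟩
      (⊤ · f ᵀ) · x       ≡⟨ ·-assoc _ _ _ ⟩
      ⊤ · (f ᵀ · x)       ∎)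

  mapping-image-pt : ∀ {f x} → mapping f → point x → point (f ᵀ · x)
  mapping-image-pt (uf , tf) px =
    univalent-image-pt uf px (⊑-trans ⊤-greatest (⊑-reflexive (sym (total⇒·⊤≡⊤ tf))))

  distinct-pts-disjoint : TarskiRule → ∀ {p q} → point p → point q → ¬ (p ≡ q) → p ⊓ q ≡ ⊥
  distinct-pts-disjoint T pp pq p≢q = ⊑‾⇒disjoint (pt-meets⇒⊑ pp T (vec-‾ (pt-vec pq))
    (λ p⊓‾q≡⊥ → p≢q (pt-⊑⇒≡ pp pq (⊓‾⇒⊑ p⊓‾q≡⊥))))

  -- Kleene star and equivalence closure

  ⋆-refl : ∀ {x} → 𝟙 ⊑ x ⋆
  ⋆-refl {x} = ⊑-trans ⊔-upperˡ (⊑-reflexive (star-unfoldˡ x))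

  ⋆-stepˡ : ∀ {x} → x · x ⋆ ⊑ x ⋆
  ⋆-stepˡ {x} = ⊑-trans ⊔-upperʳ (⊑-reflexive (star-unfoldˡ x))

  ⋆-stepʳ : ∀ {x} → x ⋆ · x ⊑ x ⋆
  ⋆-stepʳ {x} = ⊑-trans ⊔-upperʳ (⊑-reflexive (star-unfoldʳ x))

  ⋆-incl : ∀ {x} → x ⊑ x ⋆
  ⋆-incl {x} = ⊑-trans (⊑-reflexive (sym (·-identityʳ x))) (⊑-trans (·-monoʳ x ⋆-refl) ⋆-stepˡ)

  ⋆-indˡ : ∀ {x y z} → z ⊑ y → x · y ⊑ y → x ⋆ · z ⊑ y
  ⋆-indˡ {x} {y} {z} p q = star-inductˡ y x z (⊔-lub p q)

  ⋆-indʳ : ∀ {x y z} → z ⊑ y → y · x ⊑ y → z · x ⋆ ⊑ y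
  ⋆-indʳ {x} {y} {z} p q = star-inductʳ y x z (⊔-lub p q)

  ⋆-ind : ∀ {x y} → 𝟙 ⊑ y → x · y ⊑ y → x ⋆ ⊑ y
  ⋆-ind {x} {y} p q = ⊑-trans (⊑-reflexive (sym (·-identityʳ (x ⋆)))) (⋆-indˡ p q)

  ⋆-trans : ∀ {x} → x ⋆ · x ⋆ ⊑ x ⋆
  ⋆-trans = ⋆-indˡ ⊑-refl ⋆-stepˡ

  ⋆-mono : ∀ {x y} → x ⊑ y → x ⋆ ⊑ y ⋆
  ⋆-mono {x} {y} p = ⋆-ind ⋆-refl (⊑-trans (·-monoˡ (y ⋆) p) ⋆-stepˡ)

  ⋆-least : ∀ {x e} → 𝟙 ⊑ e → e · e ⊑ e → x ⊑ e → x ⋆ ⊑ e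
  ⋆-least {x} {e} r t p = ⋆-ind r (⊑-trans (·-monoˡ e p) t)

  ⋆-idem : ∀ x → (x ⋆) ⋆ ≡ x ⋆
  ⋆-idem x = ⊑-antisym (⋆-least ⋆-refl ⋆-trans ⊑-refl) ⋆-incl

  ⋆-ᵀ⊑ : ∀ x → (x ⋆) ᵀ ⊑ (x ᵀ) ⋆
  ⋆-ᵀ⊑ x = ⊑ᵀ⇒ᵀ⊑ (⋆-ind (ᵀ⊑⇒⊑ᵀ (⊑-trans (⊑-reflexive 𝟙ᵀ) ⋆-refl))
    (ᵀ⊑⇒⊑ᵀ (begin
        (x · ((x ᵀ) ⋆) ᵀ) ᵀ       ≡⟨ ᵀ-· x (((x ᵀ) ⋆) ᵀ) ⟩
        (((x ᵀ) ⋆) ᵀ) ᵀ · x ᵀ      ≡⟨ cong (_· x ᵀ) (ᵀ-invol _) ⟩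
        (x ᵀ) ⋆ · x ᵀ              ≤⟨ ⋆-stepʳ ⟩
        (x ᵀ) ⋆ ∎)))

  ⋆-ᵀ : ∀ x → (x ⋆) ᵀ ≡ (x ᵀ) ⋆
  ⋆-ᵀ x = ⊑-antisym (⋆-ᵀ⊑ x)
    (ᵀ⊑⇒⊑ᵀ (⊑-trans (⋆-ᵀ⊑ (x ᵀ)) (⊑-reflexive (cong _⋆ (ᵀ-invol x)))))

  ⋆-slide : ∀ x → x ⋆ · x ≡ x · x ⋆
  ⋆-slide x = ⊑-antisym
    (⋆-indˡ (⊑-trans (⊑-reflexive (sym (·-identityʳ x))) (·-monoʳ x ⋆-refl))
               (⊑-trans (⊑-reflexive (sym (·-assoc x x (x ⋆)))) (⊑-trans (⊑-reflexive (·-assoc x x (x ⋆))) (·-monoʳ x ⋆-stepˡ))))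
    (⋆-indʳ (⊑-trans (⊑-reflexive (sym (·-identityˡ x))) (·-monoˡ x ⋆-refl))
               (⊑-trans (⊑-reflexive (·-assoc (x ⋆) x x)) (⊑-trans (⊑-reflexive (sym (·-assoc (x ⋆) x x))) (·-monoˡ x ⋆-stepʳ))))

  ⁺⊑⋆ : ∀ {x} → x ⁺ ⊑ x ⋆
  ⁺⊑⋆ = ⋆-stepˡ

  ⋆-unfold : ∀ x → x ⋆ ≡ 𝟙 ⊔ x ⁺
  ⋆-unfold x = sym (star-unfoldˡ x)

  ⋆-unfold-· : ∀ x y → x ⋆ · y ≡ y ⊔ x ⁺ · y
  ⋆-unfold-· x y = trans (cong (_· y) (⋆-unfold x)) (trans (·-distribʳ-⊔ _ _ _) (cong (_⊔ x ⁺ · y) (·-identityˡ y)))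

  ⁺-mono : ∀ {x y} → x ⊑ y → x ⁺ ⊑ y ⁺
  ⁺-mono p = ·-mono p (⋆-mono p)

  ⁺-incl : ∀ {x} → x ⊑ x ⁺
  ⁺-incl {x} = ⊑-trans (⊑-reflexive (sym (·-identityʳ x))) (·-monoʳ x ⋆-refl)

  ⋆·⁺⊑⁺ : ∀ {x} → x ⋆ · x ⁺ ⊑ x ⁺
  ⋆·⁺⊑⁺ {x} = begin
    x ⋆ · (x · x ⋆)     ≡⟨ sym (·-assoc _ _ _) ⟩
    (x ⋆ · x) · x ⋆     ≡⟨ cong (_· x ⋆) (⋆-slide x) ⟩
    (x · x ⋆) · x ⋆     ≡⟨ ·-assoc _ _ _ ⟩
    x · (x ⋆ · x ⋆)     ≤⟨ ·-monoʳ x ⋆-trans ⟩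
    x · x ⋆ ∎

  ⁺·⋆⊑⁺ : ∀ {x} → x ⁺ · x ⋆ ⊑ x ⁺
  ⁺·⋆⊑⁺ {x} = ⊑-trans (⊑-reflexive (·-assoc x (x ⋆) (x ⋆))) (·-monoʳ x ⋆-trans)

  ⁺-least : ∀ {x y} → x ⊑ y ⁺ → x ⁺ ⊑ y ⁺
  ⁺-least {x} {y} p = begin
    x · x ⋆          ≤⟨ ·-mono p (⋆-mono (⊑-trans p ⁺⊑⋆)) ⟩
    y ⁺ · (y ⋆) ⋆    ≡⟨ cong (y ⁺ ·_) (⋆-idem y) ⟩
    y ⁺ · y ⋆        ≤⟨ ⁺·⋆⊑⁺ ⟩
    y ⁺ ∎

  ⋆-simulation : ∀ {x w z} → x · w ⊑ w · z → x ⋆ · w ⊑ w · z ⋆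
  ⋆-simulation {x} {w} {z} p = ⋆-indˡ (⊑-trans (⊑-reflexive (sym (·-identityʳ w))) (·-monoʳ w ⋆-refl))
    (begin
      x · (w · z ⋆)       ≡⟨ sym (·-assoc _ _ _) ⟩
      (x · w) · z ⋆       ≤⟨ ·-monoˡ (z ⋆) p ⟩
      (w · z) · z ⋆       ≡⟨ ·-assoc _ _ _ ⟩
      w · (z · z ⋆)       ≤⟨ ·-monoʳ w ⋆-stepˡ ⟩
      w · z ⋆ ∎)

  ⁺-simulation : ∀ {x w y} → x · w ⊑ w · y ⁺ → x ⁺ · w ⊑ w · y ⁺
  ⁺-simulation {x} {w} {y} p = begin
    (x · x ⋆) · w          ≡⟨ cong (_· w) (sym (⋆-slide x)) ⟩
    (x ⋆ · x) · w          ≡⟨ ·-assoc _ _ _ ⟩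
    x ⋆ · (x · w)          ≤⟨ ·-monoʳ (x ⋆) p ⟩
    x ⋆ · (w · y ⁺)        ≡⟨ sym (·-assoc _ _ _) ⟩
    (x ⋆ · w) · y ⁺        ≤⟨ ·-monoˡ (y ⁺) (⋆-simulation p) ⟩
    (w · (y ⁺) ⋆) · y ⁺    ≡⟨ ·-assoc _ _ _ ⟩
    w · ((y ⁺) ⋆ · y ⁺)    ≤⟨ ·-monoʳ w (·-monoˡ (y ⁺) (⋆-least ⋆-refl ⋆-trans ⁺⊑⋆)) ⟩
    w · (y ⋆ · y ⁺)        ≤⟨ ·-monoʳ w ⋆·⁺⊑⁺ ⟩
    w · y ⁺ ∎

  univalent-church-rosser : ∀ {x} → univalent x → (x ᵀ) ⋆ · x ⋆ ⊑ x ⋆ ⊔ (x ᵀ) ⋆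
  univalent-church-rosser {x} u = ⋆-indˡ ⊔-upperˡ (begin
    x ᵀ · (x ⋆ ⊔ (x ᵀ) ⋆)            ≡⟨ ·-distribˡ-⊔ _ _ _ ⟩
    x ᵀ · x ⋆ ⊔ x ᵀ · (x ᵀ) ⋆        ≡⟨ cong (λ t → x ᵀ · t ⊔ x ᵀ · (x ᵀ) ⋆) (sym (star-unfoldˡ x)) ⟩
    x ᵀ · (𝟙 ⊔ x · x ⋆) ⊔ x ᵀ · (x ᵀ) ⋆ ≤⟨ ⊔-mono (⊑-reflexive (·-distribˡ-⊔ _ _ _)) ⋆-stepˡ ⟩
    (x ᵀ · 𝟙 ⊔ x ᵀ · (x · x ⋆)) ⊔ (x ᵀ) ⋆ ≤⟨ ⊔-mono (⊔-mono (⊑-reflexive (·-identityʳ _)) (⊑-trans (⊑-reflexive (sym (·-assoc _ _ _))) (⊑-trans (·-monoˡ (x ⋆) u) (⊑-reflexive (·-identityˡ _))))) ⊑-refl ⟩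
    (x ᵀ ⊔ x ⋆) ⊔ (x ᵀ) ⋆            ≤⟨ ⊔-lub (⊔-lub (⊑-trans ⋆-incl ⊔-upperʳ) ⊔-upperˡ) ⊔-upperʳ ⟩
    x ⋆ ⊔ (x ᵀ) ⋆ ∎)

  E : S → S
  E x = (x ⊔ x ᵀ) ⋆

  E-refl : ∀ {x} → 𝟙 ⊑ E x
  E-refl = ⋆-refl

  E-trans : ∀ {x} → E x · E x ⊑ E x
  E-trans = ⋆-trans

  E-incl : ∀ {x} → x ⊑ E x
  E-incl = ⊑-trans ⊔-upperˡ ⋆-incl

  E-inclᵀ : ∀ {x} → x ᵀ ⊑ E x
  E-inclᵀ = ⊑-trans ⊔-upperʳ ⋆-incl

  E-sym : ∀ x → (E x) ᵀ ≡ E x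
  E-sym x = trans (⋆-ᵀ _) (cong _⋆ (trans (ᵀ-⊔ x (x ᵀ)) (trans (cong (x ᵀ ⊔_) (ᵀ-invol x)) (⊔-comm (x ᵀ) x))))

  E-ᵀ-closed : ∀ {x y} → y ⊑ E x → y ᵀ ⊑ E x
  E-ᵀ-closed {x} {y} p = ⊑-trans (ᵀ-mono p) (⊑-reflexive (E-sym x))

  E-least : ∀ {x y} → x ⊑ E y → E x ⊑ E y
  E-least {x} {y} p = ⋆-least E-refl E-trans (⊔-lub p (E-ᵀ-closed p))

  E-mono : ∀ {x y} → x ⊑ y → E x ⊑ E y
  E-mono p = E-least (⊑-trans p E-incl)

  E-⋆ : ∀ {x} → x ⋆ ⊑ E x
  E-⋆ = ⋆-least E-refl E-trans E-incl

  E-ᵀ⋆ : ∀ {x} → (x ᵀ) ⋆ ⊑ E x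
  E-ᵀ⋆ = ⋆-least E-refl E-trans E-inclᵀ

  E-·3 : ∀ {x u v w} → u ⊑ E x → v ⊑ E x → w ⊑ E x → u · v · w ⊑ E x
  E-·3 pu pv pow = ⊑-trans (·-mono pu (⊑-trans (·-mono pv pow) E-trans)) E-trans

  E-⊔-cong : ∀ {u v w} → E u ≡ E v → E (u ⊔ w) ≡ E (v ⊔ w)
  E-⊔-cong {u} {v} {w} Eu≡Ev = ⊑-antisym (E-⊔-mono Eu≡Ev) (E-⊔-mono (sym Eu≡Ev))
    where
    E-⊔-mono : ∀ {u v} → E u ≡ E v → E (u ⊔ w) ⊑ E (v ⊔ w)
    E-⊔-mono Eu≡Ev = E-least (⊔-lub (⊑-trans E-incl (⊑-trans (⊑-reflexive Eu≡Ev) (E-mono ⊔-upperˡ)))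
                                    (⊑-trans ⊔-upperʳ E-incl))

  univalent⇒⋆·ᵀ⋆≡E : ∀ {p} → univalent p → p ⋆ · (p ᵀ) ⋆ ≡ E p
  univalent⇒⋆·ᵀ⋆≡E {p} u = ⊑-antisym (⊑-trans (·-mono E-⋆ E-ᵀ⋆) E-trans)
    (⋆-ind (⊑-trans (⊑-reflexive (sym (·-identityˡ 𝟙))) (·-mono ⋆-refl ⋆-refl)) (begin
      (p ⊔ p ᵀ) · (p ⋆ · (p ᵀ) ⋆)                   ≡⟨ ·-distribʳ-⊔ _ _ _ ⟩
      p · (p ⋆ · (p ᵀ) ⋆) ⊔ p ᵀ · (p ⋆ · (p ᵀ) ⋆)   ≤⟨ ⊔-mono (⊑-trans (⊑-reflexive (sym (·-assoc _ _ _))) (·-monoˡ _ ⋆-stepˡ)) (⊑-reflexive (sym (·-assoc _ _ _))) ⟩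
      p ⋆ · (p ᵀ) ⋆ ⊔ (p ᵀ · p ⋆) · (p ᵀ) ⋆          ≤⟨ ⊔-mono ⊑-refl (·-monoˡ _ (⊑-trans (·-monoˡ (p ⋆) (⊑-trans (⊑-reflexive (sym (·-identityʳ (p ᵀ)))) (·-monoʳ (p ᵀ) ⋆-refl))) (·-monoˡ (p ⋆) ⋆-stepˡ))) ⟩
      p ⋆ · (p ᵀ) ⋆ ⊔ ((p ᵀ) ⋆ · p ⋆) · (p ᵀ) ⋆      ≤⟨ ⊔-mono ⊑-refl (·-monoˡ _ (univalent-church-rosser u)) ⟩
      p ⋆ · (p ᵀ) ⋆ ⊔ (p ⋆ ⊔ (p ᵀ) ⋆) · (p ᵀ) ⋆      ≡⟨ cong (p ⋆ · (p ᵀ) ⋆ ⊔_) (·-distribʳ-⊔ _ _ _) ⟩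
      p ⋆ · (p ᵀ) ⋆ ⊔ (p ⋆ · (p ᵀ) ⋆ ⊔ (p ᵀ) ⋆ · (p ᵀ) ⋆) ≤⟨ ⊔-lub ⊑-refl (⊔-lub ⊑-refl (⊑-trans ⋆-trans (⊑-trans (⊑-reflexive (sym (·-identityˡ _))) (·-monoˡ _ ⋆-refl)))) ⟩
      p ⋆ · (p ᵀ) ⋆ ∎))

  ⋆-absorbs-coreflexive : ∀ {x e} → e ⊑ 𝟙 → (x ⊔ e) ⋆ ≡ x ⋆
  ⋆-absorbs-coreflexive {x} {e} p = ⊑-antisym (⋆-least ⋆-refl ⋆-trans (⊔-lub ⋆-incl (⊑-trans p ⋆-refl))) (⋆-mono ⊔-upperˡ)

  ⁺-⊔-split : ∀ {c e} → e · c ≡ ⊥ → e · e ≡ ⊥ → (c ⊔ e) ⁺ ⊑ c ⁺ ⊔ (e ⊔ c ⁺ · e)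
  ⁺-⊔-split {c} {e} ec ee = begin
    (c ⊔ e) · (c ⊔ e) ⋆             ≡⟨ sym (⋆-slide _) ⟩
    (c ⊔ e) ⋆ · (c ⊔ e)             ≤⟨ ·-monoˡ _ c⊔e-⋆⊑ ⟩
    (c ⋆ ⊔ c ⋆ · e) · (c ⊔ e)       ≡⟨ ·-distribʳ-⊔ _ _ _ ⟩
    c ⋆ · (c ⊔ e) ⊔ (c ⋆ · e) · (c ⊔ e) ≡⟨ cong₂ _⊔_ (·-distribˡ-⊔ _ _ _) (trans (·-assoc _ _ _) (cong (c ⋆ ·_) e-ce)) ⟩
    (c ⋆ · c ⊔ c ⋆ · e) ⊔ c ⋆ · ⊥   ≡⟨ cong₂ _⊔_ (cong (_⊔ c ⋆ · e) (⋆-slide c)) (·-zeroʳ _) ⟩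
    (c ⁺ ⊔ c ⋆ · e) ⊔ ⊥             ≡⟨ ⊔-identityʳ _ ⟩
    c ⁺ ⊔ c ⋆ · e                   ≡⟨ cong (λ t → c ⁺ ⊔ t · e) (⋆-unfold c) ⟩
    c ⁺ ⊔ (𝟙 ⊔ c ⁺) · e             ≡⟨ cong (c ⁺ ⊔_) (trans (·-distribʳ-⊔ _ _ _) (cong (_⊔ c ⁺ · e) (·-identityˡ e))) ⟩
    c ⁺ ⊔ (e ⊔ c ⁺ · e) ∎
    where
    e-ce : e · (c ⊔ e) ≡ ⊥
    e-ce = trans (·-distribˡ-⊔ _ _ _) (trans (cong₂ _⊔_ ec ee) (⊔-identityʳ ⊥))
    ec⋆ : e · c ⋆ ⊑ e
    ec⋆ = begin
      e · c ⋆              ≡⟨ cong (e ·_) (⋆-unfold c) ⟩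
      e · (𝟙 ⊔ c ⁺)        ≡⟨ ·-distribˡ-⊔ _ _ _ ⟩
      e · 𝟙 ⊔ e · c ⁺      ≡⟨ cong₂ _⊔_ (·-identityʳ e) (trans (sym (·-assoc _ _ _)) (trans (cong (_· c ⋆) ec) (·-zeroˡ _))) ⟩
      e ⊔ ⊥                ≡⟨ ⊔-identityʳ e ⟩
      e ∎
    c⊔e-⋆⊑ : (c ⊔ e) ⋆ ⊑ c ⋆ ⊔ c ⋆ · e
    c⊔e-⋆⊑ = ⋆-ind (⊑-trans ⋆-refl ⊔-upperˡ) (begin
      (c ⊔ e) · (c ⋆ ⊔ c ⋆ · e)                         ≡⟨ ·-distribʳ-⊔ _ _ _ ⟩
      c · (c ⋆ ⊔ c ⋆ · e) ⊔ e · (c ⋆ ⊔ c ⋆ · e)         ≡⟨ cong₂ _⊔_ (·-distribˡ-⊔ _ _ _) (·-distribˡ-⊔ _ _ _) ⟩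
      (c · c ⋆ ⊔ c · (c ⋆ · e)) ⊔ (e · c ⋆ ⊔ e · (c ⋆ · e)) ≤⟨ ⊔-lub (⊔-mono ⋆-stepˡ (⊑-trans (⊑-reflexive (sym (·-assoc _ _ _))) (·-monoˡ e ⋆-stepˡ)))
            (⊔-lub (⊑-trans ec⋆ e⊑) (⊑-trans (⊑-reflexive (sym (·-assoc _ _ _))) (⊑-trans (·-monoˡ e ec⋆) (≡⊥⇒⊑ ee)))) ⟩
      c ⋆ ⊔ c ⋆ · e ∎)
      where
      e⊑ : e ⊑ c ⋆ ⊔ c ⋆ · e
      e⊑ = ⊑-trans (⊑-trans (⊑-reflexive (sym (·-identityˡ e))) (·-monoˡ e ⋆-refl)) ⊔-upperʳ

  -- Forests and their roots

  loopFree : S → S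
  loopFree p = p ⊓ ‾ 𝟙

  roots : S → S
  roots p = (p ⊓ 𝟙) · ⊤

  roots-vec : ∀ p → vector (roots p)
  roots-vec p = x·⊤-vec _

  coreflexive-·⊤⊓𝟙 : ∀ {e} → e ⊑ 𝟙 → (e · ⊤) ⊓ 𝟙 ≡ e
  coreflexive-·⊤⊓𝟙 {e} p = ⊑-antisym (begin
    (e · ⊤) ⊓ 𝟙            ≤⟨ dedekind e ⊤ 𝟙 ⟩
    e · (⊤ ⊓ (e ᵀ · 𝟙))    ≡⟨ cong (e ·_) (trans (⊓-identityˡ _) (trans (·-identityʳ _) (coreflexive-ᵀ p))) ⟩
    e · e                  ≤⟨ ·-monoʳ e p ⟩
    e · 𝟙                  ≡⟨ ·-identityʳ e ⟩
    e ∎) (⊓-glb x⊑x·⊤ p)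

  roots-⊓𝟙 : ∀ p → roots p ⊓ 𝟙 ≡ p ⊓ 𝟙
  roots-⊓𝟙 p = coreflexive-·⊤⊓𝟙 ⊓-lowerʳ

  roots-⊔-loopFree : ∀ {p} → total p → roots p ⊔ loopFree p · ⊤ ≡ ⊤
  roots-⊔-loopFree {p} t = begin-equality
    (p ⊓ 𝟙) · ⊤ ⊔ (p ⊓ ‾ 𝟙) · ⊤   ≡⟨ sym (·-distribʳ-⊔ ⊤ _ _) ⟩
    ((p ⊓ 𝟙) ⊔ (p ⊓ ‾ 𝟙)) · ⊤     ≡⟨ cong (_· ⊤) (sym (⊓-split p 𝟙)) ⟩
    p · ⊤                         ≡⟨ total⇒·⊤≡⊤ t ⟩
    ⊤ ∎

  roots-⊓-loopFree : ∀ {p} → univalent p → roots p ⊓ loopFree p · ⊤ ≡ ⊥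
  roots-⊓-loopFree {p} u = begin-equality
    roots p ⊓ loopFree p · ⊤             ≡⟨ sym (vec⊓𝟙· (roots-vec p) _) ⟩
    (roots p ⊓ 𝟙) · (loopFree p · ⊤)     ≡⟨ cong (_· (loopFree p · ⊤)) (roots-⊓𝟙 p) ⟩
    (p ⊓ 𝟙) · (loopFree p · ⊤)        ≡⟨ sym (·-assoc _ _ _) ⟩
    ((p ⊓ 𝟙) · loopFree p) · ⊤        ≡⟨ cong (_· ⊤) roots·nonloops≡⊥ ⟩
    ⊥ · ⊤                       ≡⟨ ·-zeroˡ ⊤ ⟩
    ⊥ ∎
    where
    roots·nonloops≡⊥ : (p ⊓ 𝟙) · loopFree p ≡ ⊥
    roots·nonloops≡⊥ = ⊑⊥⇒≡⊥ (⊑-trans (⊓-glb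
          (⊑-trans (·-mono (⊑-trans (⊑-reflexive (sym (coreflexive-ᵀ ⊓-lowerʳ))) (ᵀ-mono ⊓-lowerˡ)) ⊓-lowerˡ) u)
          (⊑-trans (·-mono ⊓-lowerʳ ⊓-lowerʳ) (⊑-reflexive (·-identityˡ _)))) (⊑-reflexive (⊓-complementʳ 𝟙)))

  loopFree-univalent : ∀ {p} → univalent p → univalent (loopFree p)
  loopFree-univalent u = ⊑-trans (·-mono (ᵀ-mono ⊓-lowerˡ) ⊓-lowerˡ) u

  module _ {p v : S} (up : univalent p) (vv : vector v) (vR : v ⊑ roots p) where
    ⊓-loopFree·⊤≡⊥ : v ⊓ loopFree p · ⊤ ≡ ⊥
    ⊓-loopFree·⊤≡⊥ = ⊑⊥⇒≡⊥ (⊑-trans (⊓-mono vR ⊑-refl) (⊑-reflexive (roots-⊓-loopFree up)))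

    ⊓-loopFree≡⊥ : v ⊓ loopFree p ≡ ⊥
    ⊓-loopFree≡⊥ = ⊑⊥⇒≡⊥ (⊑-trans (⊓-mono ⊑-refl x⊑x·⊤) (⊑-reflexive ⊓-loopFree·⊤≡⊥))

    ᵀ·loopFree≡⊥ : v ᵀ · loopFree p ≡ ⊥
    ᵀ·loopFree≡⊥ = ⊑⊥⇒≡⊥ (begin
      v ᵀ · loopFree p              ≤⟨ x⊑x·⊤ ⟩
      (v ᵀ · loopFree p) · ⊤        ≡⟨ ·-assoc _ _ _ ⟩
      v ᵀ · (loopFree p · ⊤)        ≡⟨ vecᵀ·vec vv _ ⟩
      ⊤ · (v ⊓ loopFree p · ⊤)      ≡⟨ cong (⊤ ·_) ⊓-loopFree·⊤≡⊥ ⟩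
      ⊤ · ⊥                   ≡⟨ ·-zeroʳ ⊤ ⟩
      ⊥ ∎)

    ⊓-loopFree⁺≡⊥ : v ⊓ (loopFree p) ⁺ ≡ ⊥
    ⊓-loopFree⁺≡⊥ = ⊑⊥⇒≡⊥ (⊑-trans (⊓-mono ⊑-refl (·-monoʳ (loopFree p) ⊤-greatest)) (⊑-reflexive ⊓-loopFree·⊤≡⊥))

  pᵀ-split : ∀ p → p ᵀ ≡ (loopFree p) ᵀ ⊔ (p ⊓ 𝟙) ᵀ
  pᵀ-split p = trans (cong _ᵀ (trans (⊓-split p 𝟙) (⊔-comm _ _))) (ᵀ-⊔ _ _)

  ᵀ⋆-loopFree : ∀ p → (p ᵀ) ⋆ ≡ ((loopFree p) ᵀ) ⋆
  ᵀ⋆-loopFree p = trans (cong _⋆ (pᵀ-split p)) (⋆-absorbs-coreflexive (⊑-trans (⊑-reflexive (coreflexive-ᵀ ⊓-lowerʳ)) ⊓-lowerʳ))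

  ⋆-loopFree : ∀ p → p ⋆ ≡ (loopFree p) ⋆
  ⋆-loopFree p = trans (cong _⋆ (trans (⊓-split p 𝟙) (⊔-comm _ _))) (⋆-absorbs-coreflexive ⊓-lowerʳ)

  ⁺-ᵀ : ∀ x → (x ⁺) ᵀ ≡ (x ᵀ) ⁺
  ⁺-ᵀ x = trans (ᵀ-· x (x ⋆)) (trans (cong (_· x ᵀ) (⋆-ᵀ x)) (⋆-slide (x ᵀ)))

  acyclic-cycle≡⊥ : ∀ {q y} → acyclic q → injective y → y ⊑ (q ᵀ) ⁺ · y → y ≡ ⊥
  acyclic-cycle≡⊥ {q} {y} ac iy c = ⊑⊥⇒≡⊥ (begin
    y                    ≤⟨ x⊑xxᵀx y ⟩
    y · y ᵀ · y          ≡⟨ sym (·-assoc _ _ _) ⟩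
    (y · y ᵀ) · y        ≤⟨ ·-monoˡ y yy⊥ ⟩
    ⊥ · y                ≡⟨ ·-zeroˡ y ⟩
    ⊥ ∎)
    where
    yy⊥ : y · y ᵀ ⊑ ⊥
    yy⊥ = begin
      y · y ᵀ                        ≤⟨ ⊓-glb (·-monoˡ (y ᵀ) c) iy ⟩
      ((q ᵀ) ⁺ · y) · y ᵀ ⊓ 𝟙        ≤⟨ ⊓-mono (⊑-trans (⊑-reflexive (·-assoc _ _ _)) (⊑-trans (·-monoʳ _ iy) (⊑-reflexive (·-identityʳ _)))) ⊑-refl ⟩
      (q ᵀ) ⁺ ⊓ 𝟙                    ≡⟨ cong (_⊓ 𝟙) (sym (⁺-ᵀ q)) ⟩
      (q ⁺) ᵀ ⊓ 𝟙                    ≤⟨ ⊓-mono (ᵀ-mono ac) (⊑-reflexive (sym 𝟙ᵀ)) ⟩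
      (‾ 𝟙) ᵀ ⊓ 𝟙 ᵀ                  ≡⟨ sym (ᵀ-⊓ _ _) ⟩
      (‾ 𝟙 ⊓ 𝟙) ᵀ                    ≡⟨ cong _ᵀ (⊓-complementˡ 𝟙) ⟩
      ⊥ ᵀ                            ≡⟨ ⊥ᵀ ⟩
      ⊥ ∎

  pow : S → ℕ → S → S
  pow t zero v = v
  pow t (suc n) v = t · pow t n v

  pow-+ : ∀ t m n v → pow t (m + n) v ≡ pow t m (pow t n v)
  pow-+ t zero n v = refl
  pow-+ t (suc m) n v = cong (t ·_) (pow-+ t m n v)

  pow⊑⋆ : ∀ t n v → pow t n v ⊑ t ⋆ · v
  pow⊑⋆ t zero v = ⊑-trans (⊑-reflexive (sym (·-identityˡ v))) (·-monoˡ v ⋆-refl)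
  pow⊑⋆ t (suc n) v = ⊑-trans (·-monoʳ t (pow⊑⋆ t n v)) (⊑-trans (⊑-reflexive (sym (·-assoc _ _ _))) (·-monoˡ v ⋆-stepˡ))

  pow-suc⊑⁺ : ∀ t n v → pow t (suc n) v ⊑ t ⁺ · v
  pow-suc⊑⁺ t n v = ⊑-trans (·-monoʳ t (pow⊑⋆ t n v)) (⊑-reflexive (sym (·-assoc _ _ _)))

  pow-injective : ∀ {q v} → univalent q → injective v → ∀ n → injective (pow (q ᵀ) n v)
  pow-injective uq iv zero = iv
  pow-injective uq iv (suc n) = injective-· (univalent⇒ᵀ-injective uq) (pow-injective uq iv n)

  pow-repeat⇒cycle : ∀ t v {i j} → i ℕ.< j → pow t i v ≡ pow t j v → pow t i v ⊑ t ⁺ · pow t i v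
  pow-repeat⇒cycle t v {i} {j} i<j repeat = begin
    pow t i v                     ≡⟨ repeat ⟩
    pow t j v                     ≡⟨ cong (λ n → pow t n v) j≡1+k+i ⟩
    pow t (suc k + i) v           ≡⟨ pow-+ t (suc k) i v ⟩
    pow t (suc k) (pow t i v)     ≤⟨ pow-suc⊑⁺ t k (pow t i v) ⟩
    t ⁺ · pow t i v               ∎
    where
    k = proj₁ (ℕP.m≤n⇒∃[o]m+o≡n i<j)
    j≡1+k+i : j ≡ suc k + i
    j≡1+k+i = trans (sym (proj₂ (ℕP.m≤n⇒∃[o]m+o≡n i<j))) (cong suc (ℕP.+-comm i k))

  finite-pow-vanishes : Finite S → ∀ {q x} → acyclic q → univalent q → injective x →
                        ∃ λ n → pow (q ᵀ) n x ≡ ⊥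
  finite-pow-vanishes (l , complete) {q} {x} acq uq ix =
    let i , j , i<j , same-position = FinP.pigeonhole (ℕP.n<1+n (length l)) position
    in toℕ i , acyclic-cycle≡⊥ acq (pow-injective uq ix (toℕ i))
                 (pow-repeat⇒cycle (q ᵀ) x i<j (same-entry {i} {j} same-position))
    where
    position : Fin (suc (length l)) → Fin (length l)
    position n = index (complete (pow (q ᵀ) (toℕ n) x))
    same-entry : ∀ {i j} → position i ≡ position j → pow (q ᵀ) (toℕ i) x ≡ pow (q ᵀ) (toℕ j) x
    same-entry e = trans (lookup-index (complete _))
                     (trans (cong (lookup l) e) (sym (lookup-index (complete _))))

  -- Updates and path compression

  module Update {p v z : S} (vv : vector v) (vz : vector z) where
    upd-eq : upd p v z ≡ v · z ᵀ ⊔ (‾ v ⊓ p)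
    upd-eq = cong (_⊔ (‾ v ⊓ p)) (vec-⊓-vecᵀ vv vz)

    upd⊑ : upd p v z ⊑ v · z ᵀ ⊔ p
    upd⊑ = ⊑-trans (⊑-reflexive upd-eq) (⊔-mono ⊑-refl ⊓-lowerʳ)

    v·zᵀ⊑upd : v · z ᵀ ⊑ upd p v z
    v·zᵀ⊑upd = ⊑-trans ⊔-upperˡ (⊑-reflexive (sym upd-eq))

    ‾v⊓p⊑upd : ‾ v ⊓ p ⊑ upd p v z
    ‾v⊓p⊑upd = ⊔-upperʳ

    upd-loopFree : loopFree (upd p v z) ≡ (v · z ᵀ ⊓ ‾ 𝟙) ⊔ (‾ v ⊓ loopFree p)
    upd-loopFree = trans (cong (_⊓ ‾ 𝟙) upd-eq) (trans (⊓-distribʳ-⊔ _ _ _) (cong ((v · z ᵀ ⊓ ‾ 𝟙) ⊔_) (⊓-assoc _ _ _)))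

    upd-roots : roots (upd p v z) ≡ (v ⊓ z) ⊔ (‾ v ⊓ roots p)
    upd-roots = begin-equality
      (upd p v z ⊓ 𝟙) · ⊤                          ≡⟨ cong (λ t → (t ⊓ 𝟙) · ⊤) upd-eq ⟩
      ((v · z ᵀ ⊔ (‾ v ⊓ p)) ⊓ 𝟙) · ⊤              ≡⟨ cong (_· ⊤) (⊓-distribʳ-⊔ _ _ _) ⟩
      ((v · z ᵀ ⊓ 𝟙) ⊔ ((‾ v ⊓ p) ⊓ 𝟙)) · ⊤        ≡⟨ ·-distribʳ-⊔ _ _ _ ⟩
      (v · z ᵀ ⊓ 𝟙) · ⊤ ⊔ ((‾ v ⊓ p) ⊓ 𝟙) · ⊤      ≡⟨ cong₂ _⊔_ vzᵀ⊓𝟙·⊤≡v⊓z (trans (cong (_· ⊤) (⊓-assoc _ _ _)) (vec-⊓· (vec-‾ vv) _ _)) ⟩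
      (v ⊓ z) ⊔ (‾ v ⊓ roots p) ∎
      where
      vzᵀ⊓𝟙·⊤≡v⊓z : (v · z ᵀ ⊓ 𝟙) · ⊤ ≡ v ⊓ z
      vzᵀ⊓𝟙·⊤≡v⊓z = begin-equality
        (v · z ᵀ ⊓ 𝟙) · ⊤       ≡⟨ cong (λ t → (t ⊓ 𝟙) · ⊤) (sym (vec-⊓-vecᵀ vv vz)) ⟩
        ((v ⊓ z ᵀ) ⊓ 𝟙) · ⊤     ≡⟨ cong (_· ⊤) (trans (⊓-assoc _ _ _) (cong (v ⊓_) (ᵀ⊓𝟙 _))) ⟩
        (v ⊓ (z ⊓ 𝟙)) · ⊤       ≡⟨ cong (_· ⊤) (sym (⊓-assoc _ _ _)) ⟩
        ((v ⊓ z) ⊓ 𝟙) · ⊤       ≡⟨ vec⊓𝟙·⊤ (vec-⊓ vv vz) ⟩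
        v ⊓ z ∎

  module _ {p v z : S} (mp : mapping p) (vv : vector v) (pz : point z) where
    open Update {p} {v} {z} vv (pt-vec pz)
    private
      vz = pt-vec pz
      X = v · z ᵀ
      Y = ‾ v ⊓ p
      XᵀY : X ᵀ · Y ≡ ⊥
      XᵀY = begin-equality
        (v · z ᵀ) ᵀ · (‾ v ⊓ p)       ≡⟨ cong (_· Y) (·ᵀ-ᵀ v z) ⟩
        (z · v ᵀ) · (‾ v ⊓ p)         ≡⟨ ·-assoc _ _ _ ⟩
        z · (v ᵀ · (‾ v ⊓ p))         ≡⟨ cong (z ·_) (vecᵀ·disjoint vv (vec-‾ vv) (⊓-complementʳ v) p) ⟩
        z · ⊥                         ≡⟨ ·-zeroʳ z ⟩
        ⊥ ∎
    upd-mapping : mapping (upd p v z)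
    upd-mapping = univalent-upd , ·⊤≡⊤⇒total upd·⊤≡⊤
      where
      univalent-upd : univalent (upd p v z)
      univalent-upd = begin
        (upd p v z) ᵀ · upd p v z            ≡⟨ cong (λ t → t ᵀ · t) upd-eq ⟩
        (X ⊔ Y) ᵀ · (X ⊔ Y)                  ≡⟨ cong (_· (X ⊔ Y)) (ᵀ-⊔ X Y) ⟩
        (X ᵀ ⊔ Y ᵀ) · (X ⊔ Y)                ≡⟨ ·-distribʳ-⊔ _ _ _ ⟩
        X ᵀ · (X ⊔ Y) ⊔ Y ᵀ · (X ⊔ Y)        ≡⟨ cong₂ _⊔_ (·-distribˡ-⊔ _ _ _) (·-distribˡ-⊔ _ _ _) ⟩
        (X ᵀ · X ⊔ X ᵀ · Y) ⊔ (Y ᵀ · X ⊔ Y ᵀ · Y)  ≤⟨ ⊔-lub (⊔-lub XᵀX⊑𝟙 (≡⊥⇒⊑ XᵀY)) (⊔-lub (≡⊥⇒⊑ YᵀX) YᵀY⊑𝟙) ⟩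
        𝟙 ∎
        where
        YᵀX : Y ᵀ · X ≡ ⊥
        YᵀX = trans (cong (Y ᵀ ·_) (sym (ᵀ-invol X))) (trans (sym (ᵀ-· (X ᵀ) Y)) (trans (cong _ᵀ XᵀY) ⊥ᵀ))
        XᵀX⊑𝟙 : X ᵀ · X ⊑ 𝟙
        XᵀX⊑𝟙 = begin
          (v · z ᵀ) ᵀ · (v · z ᵀ)        ≡⟨ cong (_· X) (·ᵀ-ᵀ v z) ⟩
          (z · v ᵀ) · (v · z ᵀ)          ≡⟨ ·-assoc _ _ _ ⟩
          z · (v ᵀ · (v · z ᵀ))          ≤⟨ ·-monoʳ z (⊑-trans (⊑-reflexive (sym (·-assoc _ _ _))) (·-monoˡ (z ᵀ) ⊤-greatest)) ⟩
          z · (⊤ · z ᵀ)                  ≡⟨ cong (z ·_) (sym (vecᵀ≡⊤·vecᵀ vz)) ⟩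
          z · z ᵀ                        ≤⟨ pt-inj pz ⟩
          𝟙 ∎
        YᵀY⊑𝟙 : Y ᵀ · Y ⊑ 𝟙
        YᵀY⊑𝟙 = ⊑-trans (·-mono (ᵀ-mono ⊓-lowerʳ) ⊓-lowerʳ) (proj₁ mp)
      upd·⊤≡⊤ : upd p v z · ⊤ ≡ ⊤
      upd·⊤≡⊤ = begin-equality
        upd p v z · ⊤                     ≡⟨ cong (_· ⊤) upd-eq ⟩
        (X ⊔ Y) · ⊤                       ≡⟨ ·-distribʳ-⊔ _ _ _ ⟩
        (v · z ᵀ) · ⊤ ⊔ (‾ v ⊓ p) · ⊤     ≡⟨ cong₂ _⊔_ (trans (·-assoc _ _ _) (trans (cong (v ·_) (ptᵀ⊤ pz)) vv)) (vec-⊓· (vec-‾ vv) p ⊤) ⟩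
        v ⊔ (‾ v ⊓ p · ⊤)                 ≡⟨ cong (λ t → v ⊔ (‾ v ⊓ t)) (total⇒·⊤≡⊤ (proj₂ mp)) ⟩
        v ⊔ (‾ v ⊓ ⊤)                     ≡⟨ cong (v ⊔_) (⊓-identityʳ _) ⟩
        v ⊔ ‾ v                           ≡⟨ ⊔-complementʳ v ⟩
        ⊤ ∎

  module PathCompression (fin : Finite S) {p x : S} (fp : forest p) (px : point x) where
    q = loopFree p
    A = (p ᵀ) ⋆ · x
    r = root p x
    up = proj₁ (proj₁ fp)
    tp = proj₂ (proj₁ fp)
    acq = proj₂ fp
    uq : univalent q
    uq = loopFree-univalent up
    vA : vector A
    vA = ·-vec _ (pt-vec px)
    vr : vector r
    vr = vec-⊓ vA (roots-vec p)
    r⊑A : r ⊑ A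
    r⊑A = ⊓-lowerˡ
    r⊑roots : r ⊑ roots p
    r⊑roots = ⊓-lowerʳ
    A≡ : A ≡ (q ᵀ) ⋆ · x
    A≡ = cong (_· x) (ᵀ⋆-loopFree p)

    pᵀA : p ᵀ · A ⊑ A
    pᵀA = ⊑-trans (⊑-reflexive (sym (·-assoc _ _ _))) (·-monoˡ x ⋆-stepˡ)

    -- Roots in A lie below r by the definition of r; a non-root t lies below q · (qᵀ · t) by Dedekind.
    below-r-if-parent-is : ∀ {t} → t ⊑ A → q ᵀ · t ⊑ q ⋆ · r → t ⊑ q ⋆ · r
    below-r-if-parent-is {t} t⊑A qᵀt⊑ = begin
      t                                  ≡⟨ sym (⊓-identityʳ t) ⟩
      t ⊓ ⊤                              ≡⟨ cong (t ⊓_) (sym (roots-⊔-loopFree tp)) ⟩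
      t ⊓ (roots p ⊔ q · ⊤)              ≡⟨ ⊓-distribˡ-⊔ _ _ _ ⟩
      (t ⊓ roots p) ⊔ (t ⊓ q · ⊤)        ≤⟨ ⊔-mono at-root at-non-root ⟩
      q ⋆ · r ⊔ q ⋆ · r                  ≡⟨ ⊔-idem _ ⟩
      q ⋆ · r                            ∎
      where
      at-root : t ⊓ roots p ⊑ q ⋆ · r
      at-root = ⊑-trans (⊓-mono t⊑A ⊑-refl) (⊑-trans (⊑-reflexive (sym (·-identityˡ r))) (·-monoˡ r ⋆-refl))
      at-non-root : t ⊓ q · ⊤ ⊑ q ⋆ · r
      at-non-root = begin
        t ⊓ q · ⊤                     ≡⟨ ⊓-comm _ _ ⟩
        (q · ⊤) ⊓ t                   ≤⟨ dedekind q ⊤ t ⟩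
        q · (⊤ ⊓ (q ᵀ · t))           ≡⟨ cong (q ·_) (⊓-identityˡ _) ⟩
        q · (q ᵀ · t)                 ≤⟨ ·-monoʳ q qᵀt⊑ ⟩
        q · (q ⋆ · r)                 ≡⟨ sym (·-assoc _ _ _) ⟩
        (q · q ⋆) · r                 ≤⟨ ·-monoˡ r ⋆-stepˡ ⟩
        q ⋆ · r                       ∎

    ancestors-below-r : ∀ m k → pow (q ᵀ) (m + k) x ⊑ q ⋆ · r → pow (q ᵀ) k x ⊑ q ⋆ · r
    ancestors-below-r zero k below = below
    ancestors-below-r (suc m) k below =
      below-r-if-parent-is (⊑-trans (pow⊑⋆ (q ᵀ) k x) (⊑-reflexive (sym A≡)))
        (ancestors-below-r m (suc k) (Eq.subst (λ n → pow (q ᵀ) n x ⊑ q ⋆ · r) (sym (ℕP.+-suc m k)) below))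

    -- Finiteness makes the ancestor path of x end; it ends at ⊥, which lies below r.
    x⊑q⋆r : x ⊑ q ⋆ · r
    x⊑q⋆r =
      let n , vanishes = finite-pow-vanishes fin acq uq (pt-inj px)
      in ancestors-below-r n zero (≡⊥⇒⊑ (trans (cong (λ m → pow (q ᵀ) m x) (ℕP.+-identityʳ n)) vanishes))

    x⊑p⋆r : x ⊑ p ⋆ · r
    x⊑p⋆r = ⊑-trans x⊑q⋆r (⊑-reflexive (cong (_· r) (sym (⋆-loopFree p))))

    AAᵀ⊑ : A · A ᵀ ⊑ (𝟙 ⊔ q ⁺) ⊔ (q ᵀ) ⁺
    AAᵀ⊑ = begin
      A · A ᵀ                                   ≡⟨ cong (λ t → t · t ᵀ) A≡ ⟩
      ((q ᵀ) ⋆ · x) · ((q ᵀ) ⋆ · x) ᵀ           ≡⟨ cong (((q ᵀ) ⋆ · x) ·_) (ᵀ-· _ x) ⟩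
      ((q ᵀ) ⋆ · x) · (x ᵀ · ((q ᵀ) ⋆) ᵀ)       ≡⟨ trans (·-assoc _ _ _) (cong ((q ᵀ) ⋆ ·_) (sym (·-assoc _ _ _))) ⟩
      (q ᵀ) ⋆ · ((x · x ᵀ) · ((q ᵀ) ⋆) ᵀ)       ≤⟨ ·-monoʳ _ (·-monoˡ _ (pt-inj px)) ⟩
      (q ᵀ) ⋆ · (𝟙 · ((q ᵀ) ⋆) ᵀ)               ≡⟨ cong ((q ᵀ) ⋆ ·_) (trans (·-identityˡ _) (trans (⋆-ᵀ (q ᵀ)) (cong _⋆ (ᵀ-invol q)))) ⟩
      (q ᵀ) ⋆ · q ⋆                             ≤⟨ univalent-church-rosser uq ⟩
      q ⋆ ⊔ (q ᵀ) ⋆                             ≡⟨ cong₂ _⊔_ (⋆-unfold q) (⋆-unfold (q ᵀ)) ⟩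
      (𝟙 ⊔ q ⁺) ⊔ (𝟙 ⊔ (q ᵀ) ⁺)                 ≤⟨ ⊔-lub ⊔-upperˡ (⊔-lub (⊑-trans ⊔-upperˡ ⊔-upperˡ) ⊔-upperʳ) ⟩
      (𝟙 ⊔ q ⁺) ⊔ (q ᵀ) ⁺                       ∎

    r⊓q⁺ : r ⊓ q ⁺ ≡ ⊥
    r⊓q⁺ = ⊓-loopFree⁺≡⊥ up vr r⊑roots

    rᵀ⊓qᵀ⁺ : r ᵀ ⊓ (q ᵀ) ⁺ ≡ ⊥
    rᵀ⊓qᵀ⁺ = begin-equality
      r ᵀ ⊓ (q ᵀ) ⁺        ≡⟨ cong (r ᵀ ⊓_) (sym (⁺-ᵀ q)) ⟩
      r ᵀ ⊓ (q ⁺) ᵀ        ≡⟨ sym (ᵀ-⊓ r (q ⁺)) ⟩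
      (r ⊓ q ⁺) ᵀ          ≡⟨ cong _ᵀ r⊓q⁺ ⟩
      ⊥ ᵀ                  ≡⟨ ⊥ᵀ ⟩
      ⊥                    ∎

    Arᵀ⊑ : A · r ᵀ ⊑ q ⋆
    Arᵀ⊑ = begin
      A · r ᵀ        ≤⟨ ⊑⊔-disjoint (⊑-trans (·-monoʳ A (ᵀ-mono r⊑A)) AAᵀ⊑) (⊑⊥⇒≡⊥ (⊑-trans (⊓-mono Arᵀ⊑rᵀ ⊑-refl) (⊑-reflexive rᵀ⊓qᵀ⁺))) ⟩
      𝟙 ⊔ q ⁺        ≡⟨ sym (⋆-unfold q) ⟩
      q ⋆            ∎
      where
      Arᵀ⊑rᵀ : A · r ᵀ ⊑ r ᵀ
      Arᵀ⊑rᵀ = ⊑-trans (·-monoˡ (r ᵀ) ⊤-greatest) (⊑-reflexive (sym (vecᵀ≡⊤·vecᵀ vr)))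

    r-inj : injective r
    r-inj = ⊑⊔-disjoint (⊑-trans (·-monoˡ (r ᵀ) r⊑A) (⊑-trans Arᵀ⊑ (⊑-reflexive (⋆-unfold q))))
                        (⊑⊥⇒≡⊥ (⊑-trans (⊓-mono (vec-·ᵀ⊑ vr) ⊑-refl) (⊑-reflexive r⊓q⁺)))

    r-surj : ⊤ · r ≡ ⊤
    r-surj = ⊑-antisym ⊤-greatest (begin
      ⊤                 ≡⟨ sym (pt-⊤ px) ⟩
      ⊤ · x             ≤⟨ ·-monoʳ ⊤ x⊑q⋆r ⟩
      ⊤ · (q ⋆ · r)     ≡⟨ sym (·-assoc _ _ _) ⟩
      (⊤ · q ⋆) · r     ≤⟨ ·-monoˡ r ⊤-greatest ⟩
      ⊤ · r             ∎)

    r-pt : point r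
    r-pt = vr , r-inj , ⊤·≡⊤⇒surjective r-surj

    Arᵀ⊓‾1 : A · r ᵀ ⊓ ‾ 𝟙 ⊑ q ⁺
    Arᵀ⊓‾1 = shunting (⊑-trans Arᵀ⊑ (⊑-trans (⊑-reflexive (⋆-unfold q)) (⊔-mono (⊑-reflexive (sym (‾-involutive 𝟙))) ⊑-refl)))

    p' = upd p A r
    open Update {p} {A} {r} vA vr

    pc-loopFree : loopFree p' ⊑ q ⁺
    pc-loopFree = ⊑-trans (⊑-reflexive upd-loopFree) (⊔-lub Arᵀ⊓‾1 (⊑-trans ⊓-lowerʳ ⁺-incl))

    pc-forest : forest p'
    pc-forest = upd-mapping (proj₁ fp) vA r-pt , ⊑-trans (⁺-least pc-loopFree) acq

    pc-roots : roots p' ≡ roots p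
    pc-roots = begin-equality
      roots p'                           ≡⟨ upd-roots ⟩
      (A ⊓ r) ⊔ (‾ A ⊓ roots p)          ≡⟨ cong (_⊔ (‾ A ⊓ roots p)) (trans (sym (⊓-assoc A A (roots p))) (cong (_⊓ roots p) (⊓-idem A))) ⟩
      (A ⊓ roots p) ⊔ (‾ A ⊓ roots p)       ≡⟨ sym (⊓-distribʳ-⊔ _ _ _) ⟩
      (A ⊔ ‾ A) ⊓ roots p                ≡⟨ cong (_⊓ roots p) (⊔-complementʳ A) ⟩
      ⊤ ⊓ roots p                        ≡⟨ ⊓-identityˡ _ ⟩
      roots p ∎

    pc-E : E p' ≡ E p
    pc-E = ⊑-antisym (E-least (⊑-trans upd⊑ (⊔-lub (⊑-trans Arᵀ⊑ (⊑-trans (⊑-reflexive (sym (⋆-loopFree p))) E-⋆)) E-incl)))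
                     (E-least p⊑E)
      where
      A⊓p-ᵀ⊑A : (A ⊓ p) ᵀ ⊑ A
      A⊓p-ᵀ⊑A = begin
        (A ⊓ p) ᵀ              ≤⟨ x⊑x·⊤ ⟩
        (A ⊓ p) ᵀ · ⊤          ≡⟨ cong (λ t → t ᵀ · ⊤) (sym (vec⊓𝟙· vA p)) ⟩
        ((A ⊓ 𝟙) · p) ᵀ · ⊤    ≡⟨ cong (_· ⊤) (trans (ᵀ-· _ p) (cong (p ᵀ ·_) (⊓𝟙-ᵀ _))) ⟩
        (p ᵀ · (A ⊓ 𝟙)) · ⊤    ≡⟨ ·-assoc _ _ _ ⟩
        p ᵀ · ((A ⊓ 𝟙) · ⊤)    ≡⟨ cong (p ᵀ ·_) (vec⊓𝟙·⊤ vA) ⟩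
        p ᵀ · A                ≤⟨ pᵀA ⟩
        A ∎
      AAᵀ⊑E : A · A ᵀ ⊑ E p'
      AAᵀ⊑E = begin
        A · A ᵀ                    ≡⟨ cong (_· A ᵀ) (sym (·-identityʳ A)) ⟩
        (A · 𝟙) · A ᵀ              ≤⟨ ·-monoˡ (A ᵀ) (·-monoʳ A (pt-surj r-pt)) ⟩
        (A · (r ᵀ · r)) · A ᵀ      ≡⟨ trans (cong (_· A ᵀ) (sym (·-assoc _ _ _))) (·-assoc _ _ _) ⟩
        (A · r ᵀ) · (r · A ᵀ)      ≡⟨ cong ((A · r ᵀ) ·_) (sym (·ᵀ-ᵀ A r)) ⟩
        (A · r ᵀ) · (A · r ᵀ) ᵀ    ≤⟨ ·-mono (⊑-trans v·zᵀ⊑upd E-incl) (ᵀ-mono (⊑-trans v·zᵀ⊑upd E-incl)) ⟩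
        E p' · (E p') ᵀ            ≡⟨ cong (E p' ·_) (E-sym p') ⟩
        E p' · E p'                ≤⟨ E-trans ⟩
        E p' ∎
      p⊑E : p ⊑ E p'
      p⊑E = begin
        p                           ≡⟨ ⊓-split p A ⟩
        (p ⊓ A) ⊔ (p ⊓ ‾ A)         ≤⟨ ⊔-mono (⊓-glb ⊓-lowerʳ (⊑-trans (⊑-reflexive (⊓-comm p A)) (ᵀ⊑⇒⊑ᵀ A⊓p-ᵀ⊑A))) (⊑-trans (⊑-reflexive (⊓-comm p (‾ A))) (⊑-trans ‾v⊓p⊑upd E-incl)) ⟩
        (A ⊓ (A ᵀ)) ⊔ E p'          ≡⟨ cong (_⊔ E p') (vec-⊓-vecᵀ vA vA) ⟩
        A · A ᵀ ⊔ E p'              ≤⟨ ⊔-lub AAᵀ⊑E ⊑-refl ⟩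
        E p' ∎

    pc-rank : ∀ {rank w} → q · rank ⊑ rank · w ⁺ → loopFree p' · rank ⊑ rank · w ⁺
    pc-rank h = ⊑-trans (·-monoˡ _ pc-loopFree) (⁺-simulation h)

  -- Linking two roots

  module Linking {p x y : S} (fp : forest p) (px : point x) (py : point y)
              (xR : x ⊑ roots p) (yR : y ⊑ roots p) where
    q = loopFree p
    up = proj₁ (proj₁ fp)
    vx = pt-vec px
    vy = pt-vec py
    p' = upd p x y
    open Update {p} {x} {y} vx vy
    e = x · y ᵀ ⊓ ‾ 𝟙
    c = ‾ x ⊓ q

    yᵀq : y ᵀ · q ≡ ⊥
    yᵀq = ᵀ·loopFree≡⊥ up vy yR

    e⊑‾y : e ⊑ ‾ y
    e⊑‾y = disjoint⇒⊑‾ (⊑⊥⇒≡⊥ (begin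
      (x · y ᵀ ⊓ ‾ 𝟙) ⊓ y          ≤⟨ ⊓-glb (⊑-trans ⊓-lowerˡ ⊓-lowerʳ) (⊓-mono (⊓-lowerˡ {x · y ᵀ}) ⊑-refl) ⟩
      ‾ 𝟙 ⊓ (x · y ᵀ ⊓ y)          ≤⟨ ⊓-mono ⊑-refl xyᵀ⊓y⊑𝟙 ⟩
      ‾ 𝟙 ⊓ 𝟙                      ≡⟨ ⊓-complementˡ 𝟙 ⟩
      ⊥ ∎))
      where
      xyᵀ⊓y⊑𝟙 : x · y ᵀ ⊓ y ⊑ 𝟙
      xyᵀ⊓y⊑𝟙 = begin
        x · y ᵀ ⊓ y          ≡⟨ cong (_⊓ y) (sym (vec-⊓-vecᵀ vx vy)) ⟩
        (x ⊓ y ᵀ) ⊓ y        ≡⟨ trans (⊓-comm _ _) (sym (⊓-assoc _ _ _)) ⟩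
        (y ⊓ x) ⊓ y ᵀ        ≡⟨ vec-⊓-vecᵀ (vec-⊓ vy vx) vy ⟩
        (y ⊓ x) · y ᵀ        ≤⟨ ·-monoˡ (y ᵀ) ⊓-lowerˡ ⟩
        y · y ᵀ              ≤⟨ pt-inj py ⟩
        𝟙 ∎

    yᵀe : y ᵀ · e ≡ ⊥
    yᵀe = trans (cong (y ᵀ ·_) (sym (trans (⊓-comm _ _) (⊑⇒⊓ e⊑‾y))))
                (vecᵀ·disjoint vy (vec-‾ vy) (⊓-complementʳ y) e)

    e⊑xyᵀ : e ⊑ x · y ᵀ
    e⊑xyᵀ = ⊓-lowerˡ

    ec : e · c ≡ ⊥
    ec = ⊑⊥⇒≡⊥ (begin
      e · c                 ≤⟨ ·-mono e⊑xyᵀ ⊓-lowerʳ ⟩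
      (x · y ᵀ) · q         ≡⟨ ·-assoc _ _ _ ⟩
      x · (y ᵀ · q)         ≡⟨ cong (x ·_) yᵀq ⟩
      x · ⊥                 ≡⟨ ·-zeroʳ x ⟩
      ⊥ ∎)

    ee : e · e ≡ ⊥
    ee = ⊑⊥⇒≡⊥ (begin
      e · e                 ≤⟨ ·-monoˡ e e⊑xyᵀ ⟩
      (x · y ᵀ) · e         ≡⟨ ·-assoc _ _ _ ⟩
      x · (y ᵀ · e)         ≡⟨ cong (x ·_) yᵀe ⟩
      x · ⊥                 ≡⟨ ·-zeroʳ x ⟩
      ⊥ ∎)

    loopFree-linked : loopFree p' ≡ e ⊔ c
    loopFree-linked = upd-loopFree

    c⁺e : c ⁺ · e ⊑ ‾ 𝟙
    c⁺e = disjoint⇒⊑‾ (⊑⊥⇒≡⊥ (begin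
      c ⁺ · e ⊓ 𝟙                   ≤⟨ ⊓-mono (·-monoʳ (c ⁺) e⊑xyᵀ) ⊑-refl ⟩
      c ⁺ · (x · y ᵀ) ⊓ 𝟙           ≡⟨ cong (_⊓ 𝟙) (sym (·-assoc _ _ _)) ⟩
      (c ⁺ · x) · y ᵀ ⊓ 𝟙           ≤⟨ dedekindʳ (c ⁺ · x) (y ᵀ) 𝟙 ⟩
      ((c ⁺ · x) ⊓ (𝟙 · (y ᵀ) ᵀ)) · y ᵀ ≡⟨ cong (λ t → ((c ⁺ · x) ⊓ t) · y ᵀ) (trans (·-identityˡ _) (ᵀ-invol y)) ⟩
      ((c ⁺ · x) ⊓ y) · y ᵀ         ≤⟨ ·-monoˡ (y ᵀ) (⊑-trans (⊓-mono xyᵀ⊓y⊑𝟙 ⊑-refl) (⊑-reflexive (trans (⊓-comm _ _) (⊓-loopFree·⊤≡⊥ up vy yR)))) ⟩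
      ⊥ · y ᵀ                       ≡⟨ ·-zeroˡ _ ⟩
      ⊥ ∎))
      where
      xyᵀ⊓y⊑𝟙 : c ⁺ · x ⊑ q · ⊤
      xyᵀ⊓y⊑𝟙 = ⊑-trans (⊑-reflexive (·-assoc _ _ _)) (·-mono ⊓-lowerʳ ⊤-greatest)

    -- Since y is a root, nothing follows the new edge e; a cycle through e would have to lead
    -- from y back to x along old edges c, which start from non-roots only.
    lk-forest : forest p'
    lk-forest = upd-mapping (proj₁ fp) vx py ,
      ⊑-trans (⊑-reflexive (cong _⁺ (trans loopFree-linked (⊔-comm e c))))
        (⊑-trans (⁺-⊔-split ec ee)
          (⊔-lub (⊑-trans (⁺-mono ⊓-lowerʳ) (proj₂ fp)) (⊔-lub ⊓-lowerʳ c⁺e)))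

    lk-roots : roots p' ≡ (x ⊓ y) ⊔ (‾ x ⊓ roots p)
    lk-roots = upd-roots

    lk-roots⊑ : roots p' ⊑ roots p
    lk-roots⊑ = ⊑-trans (⊑-reflexive lk-roots) (⊔-lub (⊑-trans ⊓-lowerʳ yR) ⊓-lowerʳ)

    lk-E : E p' ≡ E (p ⊔ x · y ᵀ)
    lk-E = ⊑-antisym (E-mono (⊑-trans upd⊑ (⊑-reflexive (⊔-comm _ _))))
      (E-least (⊔-lub p⊑E (⊑-trans v·zᵀ⊑upd E-incl)))
      where
      p⊑E : p ⊑ E p'
      p⊑E = begin
        p                                 ≡⟨ ⊓-split p x ⟩
        (p ⊓ x) ⊔ (p ⊓ ‾ x)               ≤⟨ ⊔-mono xyᵀ⊓y⊑𝟙 (⊑-trans (⊑-reflexive (⊓-comm _ _)) (⊑-trans ‾v⊓p⊑upd E-incl)) ⟩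
        E p' ⊔ E p'                       ≡⟨ ⊔-idem _ ⟩
        E p' ∎
        where
        xyᵀ⊓y⊑𝟙 : p ⊓ x ⊑ E p'
        xyᵀ⊓y⊑𝟙 = begin
          p ⊓ x                                ≡⟨ cong (_⊓ x) (trans (⊓-split p 𝟙) refl) ⟩
          ((p ⊓ 𝟙) ⊔ q) ⊓ x                    ≡⟨ ⊓-distribʳ-⊔ _ _ _ ⟩
          ((p ⊓ 𝟙) ⊓ x) ⊔ (q ⊓ x)              ≡⟨ cong (((p ⊓ 𝟙) ⊓ x) ⊔_) (trans (⊓-comm _ _) (⊓-loopFree≡⊥ up vx xR)) ⟩
          ((p ⊓ 𝟙) ⊓ x) ⊔ ⊥                    ≤⟨ ⊔-lub (⊑-trans ⊓-lowerˡ (⊑-trans ⊓-lowerʳ E-refl)) ⊥-least ⟩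
          E p' ∎

    lk-rank : ∀ {rank w} → q · rank ⊑ rank · w → x · y ᵀ · rank ⊑ rank · w → loopFree p' · rank ⊑ rank · w
    lk-rank {rank} {w} hq he = begin
      loopFree p' · rank                   ≡⟨ cong (_· rank) loopFree-linked ⟩
      (e ⊔ c) · rank                 ≡⟨ ·-distribʳ-⊔ _ _ _ ⟩
      e · rank ⊔ c · rank            ≤⟨ ⊔-lub (⊑-trans (⊑-trans (·-monoˡ rank e⊑xyᵀ) (⊑-reflexive (·-assoc _ _ _))) he)
                                             (⊑-trans (·-monoˡ rank ⊓-lowerʳ) hq) ⟩
      rank · w ∎

  edge-rank : ∀ {rank w x y} → mapping rank → point x → point y →
              rank ᵀ · x ⊑ w · (rank ᵀ · y) → x · y ᵀ · rank ⊑ rank · w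
  edge-rank {rank} {w} {x} {y} mr px py h = begin
    x · (y ᵀ · rank)                     ≡⟨ cong (x ·_) (sym Q≡) ⟩
    x · (rank ᵀ · y) ᵀ                   ≤⟨ ·-monoʳ x (ᵀ-mono rank-dual) ⟩
    x · (w ᵀ · (rank ᵀ · x)) ᵀ           ≡⟨ cong (x ·_) (trans (ᵀ-· (w ᵀ) _) (cong₂ _·_ Q≡' (ᵀ-invol w))) ⟩
    x · ((x ᵀ · rank) · w)               ≡⟨ trans (cong (x ·_) (·-assoc _ _ _)) (sym (·-assoc _ _ _)) ⟩
    (x · x ᵀ) · (rank · w)               ≤⟨ ·-monoˡ _ (pt-inj px) ⟩
    𝟙 · (rank · w)                       ≡⟨ ·-identityˡ _ ⟩
    rank · w ∎
    where
    rank-dual : rank ᵀ · y ⊑ w ᵀ · (rank ᵀ · x)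
    rank-dual = pt-dual (mapping-image-pt mr px) (mapping-image-pt mr py) w h
    Q≡ : (rank ᵀ · y) ᵀ ≡ y ᵀ · rank
    Q≡ = trans (ᵀ-· (rank ᵀ) y) (cong (y ᵀ ·_) (ᵀ-invol rank))
    Q≡' : (rank ᵀ · x) ᵀ ≡ x ᵀ · rank
    Q≡' = trans (ᵀ-· (rank ᵀ) x) (cong (x ᵀ ·_) (ᵀ-invol rank))

  module UnionEquivalence {p₀ x y r s : S} (px : point x) (py : point y) (pr : point r) (ps : point s)
             (xr : x ⊑ E p₀ · r) (ys : y ⊑ E p₀ · s) where
    E₀ = E p₀
    W = p₀ ⊔ x · y ᵀ
    rx : r ⊑ E₀ · x
    rx = ⊑-trans (pt-dual px pr E₀ xr) (⊑-reflexive (cong (_· x) (E-sym p₀)))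
    sy : s ⊑ E₀ · y
    sy = ⊑-trans (pt-dual py ps E₀ ys) (⊑-reflexive (cong (_· y) (E-sym p₀)))

    joined-via : ∀ {u v u' v' w} → u ⊑ E₀ · u' → v ⊑ E₀ · v' → u' · v' ᵀ ⊑ E (p₀ ⊔ w) → u · v ᵀ ⊑ E (p₀ ⊔ w)
    joined-via {u} {v} {u'} {v'} {w} hu hv hw = begin
      u · v ᵀ                         ≤⟨ ·-mono hu (ᵀ-mono hv) ⟩
      (E₀ · u') · (E₀ · v') ᵀ         ≡⟨ cong ((E₀ · u') ·_) (trans (ᵀ-· E₀ v') (cong (v' ᵀ ·_) (E-sym p₀))) ⟩
      (E₀ · u') · (v' ᵀ · E₀)         ≡⟨ trans (·-assoc _ _ _) (cong (E₀ ·_) (sym (·-assoc _ _ _))) ⟩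
      E₀ · (u' · v' ᵀ) · E₀           ≤⟨ E-·3 (E-mono ⊔-upperˡ) hw (E-mono ⊔-upperˡ) ⟩
      E (p₀ ⊔ w) ∎

    E-linking-r-s : E (p₀ ⊔ r · s ᵀ) ≡ E W
    E-linking-r-s = ⊑-antisym (E-least (⊔-lub (⊑-trans ⊔-upperˡ E-incl) (joined-via rx sy (⊑-trans ⊔-upperʳ E-incl))))
                      (E-least (⊔-lub (⊑-trans ⊔-upperˡ E-incl) (joined-via xr ys (⊑-trans ⊔-upperʳ E-incl))))

    E-linking-s-r : E (p₀ ⊔ s · r ᵀ) ≡ E W
    E-linking-s-r = ⊑-antisym (E-least (⊔-lub (⊑-trans ⊔-upperˡ E-incl) (flip-edge (joined-via rx sy (⊑-trans ⊔-upperʳ E-incl)))))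
                      (E-least (⊔-lub (⊑-trans ⊔-upperˡ E-incl) (joined-via xr ys (⊑-trans (⊑-reflexive rsᵀ) (⊑-trans (ᵀ-mono ⊔-upperʳ) E-inclᵀ)))))
      where
      rsᵀ : r · s ᵀ ≡ (s · r ᵀ) ᵀ
      rsᵀ = sym (·ᵀ-ᵀ s r)
      flip-edge : r · s ᵀ ⊑ E W → s · r ᵀ ⊑ E W
      flip-edge h = ⊑-trans (⊑-reflexive (sym (·ᵀ-ᵀ r s))) (E-ᵀ-closed h)

    E-same-root : r ≡ s → E p₀ ≡ E W
    E-same-root refl = ⊑-antisym (E-mono ⊔-upperˡ) (E-least (⊔-lub E-incl (begin
      x · y ᵀ                         ≤⟨ joined-via {w = ⊥} xr ys (⊑-trans (pt-inj pr) (⊑-trans E-refl (E-mono (⊑-reflexive (sym (⊔-identityʳ p₀)))))) ⟩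
      E (p₀ ⊔ ⊥)                      ≡⟨ cong E (⊔-identityʳ p₀) ⟩
      E p₀ ∎)))

  injective-vec-absorbs : ∀ {u w} → vector u → injective u → vector w → w ⊑ u → u · (⊤ · w) ⊑ w
  injective-vec-absorbs {u} {w} vu iu vw wu = begin
    u · (⊤ · w)                ≡⟨ cong (λ t → u · (⊤ · t)) (sym (vec⊓𝟙·⊤ vw)) ⟩
    u · (⊤ · ((w ⊓ 𝟙) · ⊤))    ≡⟨ cong (u ·_) (sym (·-assoc _ _ _)) ⟩
    u · ((⊤ · (w ⊓ 𝟙)) · ⊤)    ≡⟨ cong (λ t → u · (t · ⊤)) ⊤·w⊓𝟙≡wᵀ ⟩
    u · (w ᵀ · ⊤)              ≡⟨ sym (·-assoc _ _ _) ⟩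
    (u · w ᵀ) · ⊤              ≤⟨ ·-monoˡ ⊤ uw ⟩
    w · ⊤                      ≡⟨ vw ⟩
    w ∎
    where
    ⊤·w⊓𝟙≡wᵀ : ⊤ · (w ⊓ 𝟙) ≡ w ᵀ
    ⊤·w⊓𝟙≡wᵀ = trans (cong₂ _·_ (sym ⊤ᵀ) (sym (⊓𝟙-ᵀ _))) (trans (sym (ᵀ-· (w ⊓ 𝟙) ⊤)) (cong _ᵀ (vec⊓𝟙·⊤ vw)))
    uw : u · w ᵀ ⊑ w
    uw = begin
      u · w ᵀ                   ≤⟨ ⊓-glb ⊑-refl (⊑-trans (·-monoʳ u (ᵀ-mono wu)) iu) ⟩
      u · w ᵀ ⊓ 𝟙               ≡⟨ cong (_⊓ 𝟙) (sym (vec-⊓-vecᵀ vu vw)) ⟩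
      (u ⊓ w ᵀ) ⊓ 𝟙             ≡⟨ trans (⊓-assoc _ _ _) (cong (u ⊓_) (ᵀ⊓𝟙 _)) ⟩
      u ⊓ (w ⊓ 𝟙)               ≤⟨ ⊑-trans ⊓-lowerʳ ⊓-lowerˡ ⟩
      w ∎

  -- π exchanges the points m and u and is the identity outside them.
  module Swap {m u : S} (pm : point m) (pu : point u) where
    vm = pt-vec pm
    vu = pt-vec pu
    w = ‾ m ⊓ ‾ u
    vw : vector w
    vw = vec-⊓ (vec-‾ vm) (vec-‾ vu)
    d = w ⊓ 𝟙
    P = m · u ᵀ
    Q = u · m ᵀ
    π = d ⊔ (P ⊔ Q)

    dᵀ : d ᵀ ≡ d
    dᵀ = ⊓𝟙-ᵀ _

    module TwoPoints {a b : S} (pa : point a) (pb : point b) where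
      bab : b · a ᵀ · b ⊑ a
      bab = begin
        b · a ᵀ · b             ≡⟨ sym (·-assoc _ _ _) ⟩
        (b · a ᵀ) · b           ≡⟨ cong (_· b) (trans (sym (vec-⊓-vecᵀ (pt-vec pb) (pt-vec pa))) (⊓vecᵀ (pt-vec pa) b)) ⟩
        (b · (a ⊓ 𝟙)) · b       ≡⟨ trans (·-assoc _ _ _) (cong (b ·_) (vec⊓𝟙· (pt-vec pa) b)) ⟩
        b · (a ⊓ b)             ≤⟨ ·-monoʳ b x⊑⊤·x ⟩
        b · (⊤ · (a ⊓ b))       ≤⟨ injective-vec-absorbs (pt-vec pb) (pt-inj pb) (vec-⊓ (pt-vec pa) (pt-vec pb)) ⊓-lowerʳ ⟩
        a ⊓ b                   ≤⟨ ⊓-lowerˡ ⟩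
        a ∎
      abab : (a · b ᵀ) · (a · b ᵀ) ⊑ 𝟙
      abab = begin
        (a · b ᵀ) · (a · b ᵀ)   ≡⟨ ·-assoc _ _ _ ⟩
        a · (b ᵀ · (a · b ᵀ))   ≡⟨ cong (a ·_) (sym (trans (ᵀ-· b (a ᵀ · b)) (trans (cong (_· b ᵀ) (trans (ᵀ-· (a ᵀ) b) (cong (b ᵀ ·_) (ᵀ-invol a)))) (·-assoc _ _ _)))) ⟩
        a · (b · a ᵀ · b) ᵀ     ≤⟨ ·-monoʳ a (ᵀ-mono bab) ⟩
        a · a ᵀ                 ≤⟨ pt-inj pa ⟩
        𝟙 ∎
      abba : (a · b ᵀ) · (b · a ᵀ) ⊑ 𝟙
      abba = begin
        (a · b ᵀ) · (b · a ᵀ)   ≡⟨ trans (·-assoc _ _ _) (cong (a ·_) (sym (·-assoc _ _ _))) ⟩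
        a · ((b ᵀ · b) · a ᵀ)   ≤⟨ ·-monoʳ a (·-monoˡ (a ᵀ) ⊤-greatest) ⟩
        a · (⊤ · a ᵀ)           ≡⟨ cong (a ·_) (sym (vecᵀ≡⊤·vecᵀ (pt-vec pa))) ⟩
        a · a ᵀ                 ≤⟨ pt-inj pa ⟩
        𝟙 ∎

    dX : ∀ {a b} → point a → point b → w ⊑ ‾ a → d · (a · b ᵀ) ≡ ⊥
    dX {a} {b} pa pb wa = begin-equality
      d · (a · b ᵀ)             ≡⟨ sym (·-assoc _ _ _) ⟩
      (d · a) · b ᵀ             ≡⟨ cong (_· b ᵀ) (vec⊓𝟙· vw a) ⟩
      (w ⊓ a) · b ᵀ             ≡⟨ cong (_· b ᵀ) (⊑‾⇒disjoint wa) ⟩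
      ⊥ · b ᵀ                   ≡⟨ ·-zeroˡ _ ⟩
      ⊥ ∎

    Xd : ∀ {a b} → point a → point b → w ⊑ ‾ b → (a · b ᵀ) · d ≡ ⊥
    Xd {a} {b} pa pb wb = begin-equality
      (a · b ᵀ) · d             ≡⟨ cong ((a · b ᵀ) ·_) (sym dᵀ) ⟩
      (a · b ᵀ) · d ᵀ           ≡⟨ ·-assoc _ _ _ ⟩
      a · (b ᵀ · d ᵀ)           ≡⟨ cong (a ·_) (sym (ᵀ-· d b)) ⟩
      a · (d · b) ᵀ             ≡⟨ cong (λ t → a · t ᵀ) (trans (vec⊓𝟙· vw b) (⊑‾⇒disjoint wb)) ⟩
      a · ⊥ ᵀ                   ≡⟨ trans (cong (a ·_) ⊥ᵀ) (·-zeroʳ a) ⟩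
      ⊥ ∎

    π-sym : π ᵀ ≡ π
    π-sym = begin-equality
      (d ⊔ (P ⊔ Q)) ᵀ           ≡⟨ trans (ᵀ-⊔ _ _) (cong (d ᵀ ⊔_) (ᵀ-⊔ _ _)) ⟩
      d ᵀ ⊔ (P ᵀ ⊔ Q ᵀ)         ≡⟨ cong₂ _⊔_ dᵀ (trans (cong₂ _⊔_ (·ᵀ-ᵀ m u) (·ᵀ-ᵀ u m)) (⊔-comm _ _)) ⟩
      d ⊔ (P ⊔ Q) ∎

    π-sq : π · π ⊑ 𝟙
    π-sq = begin
      π · π                                       ≡⟨ ·-distribʳ-⊔ _ _ _ ⟩
      d · π ⊔ (P ⊔ Q) · π                         ≡⟨ cong (d · π ⊔_) (·-distribʳ-⊔ _ _ _) ⟩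
      d · π ⊔ (P · π ⊔ Q · π)                     ≤⟨ ⊔-lub (row-d) (⊔-lub row-P row-Q) ⟩
      𝟙 ∎
      where
      wm : w ⊑ ‾ m
      wm = ⊓-lowerˡ
      wu : w ⊑ ‾ u
      wu = ⊓-lowerʳ
      expand : ∀ Y → Y · π ≡ Y · d ⊔ (Y · P ⊔ Y · Q)
      expand Y = trans (·-distribˡ-⊔ _ _ _) (cong (Y · d ⊔_) (·-distribˡ-⊔ _ _ _))
      row-d : d · π ⊑ 𝟙
      row-d = ⊑-trans (⊑-reflexive (expand d)) (⊔-lub (⊑-trans (·-monoʳ d ⊓-lowerʳ) (⊑-trans (⊑-reflexive (·-identityʳ d)) ⊓-lowerʳ))
                (⊔-lub (≡⊥⇒⊑ (dX pm pu wm)) (≡⊥⇒⊑ (dX pu pm wu))))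
      row-P : P · π ⊑ 𝟙
      row-P = ⊑-trans (⊑-reflexive (expand P)) (⊔-lub (≡⊥⇒⊑ (Xd pm pu wu)) (⊔-lub (TwoPoints.abab pm pu) (TwoPoints.abba pm pu)))
      row-Q : Q · π ⊑ 𝟙
      row-Q = ⊑-trans (⊑-reflexive (expand Q)) (⊔-lub (≡⊥⇒⊑ (Xd pu pm wm)) (⊔-lub (TwoPoints.abba pu pm) (TwoPoints.abab pu pm)))

    π-move : ∀ {M} → vector M → u ⊑ M → M ⊓ ‾ u ⊑ π · (M ⊓ ‾ m)
    π-move {M} vM uM = begin
      M ⊓ ‾ u                                  ≡⟨ ⊓-split (M ⊓ ‾ u) (‾ m) ⟩
      ((M ⊓ ‾ u) ⊓ ‾ m) ⊔ ((M ⊓ ‾ u) ⊓ ‾ (‾ m)) ≤⟨ ⊔-mono off-m at-m ⟩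
      d · N ⊔ P · N                            ≤⟨ ⊔-lub (·-monoˡ N ⊔-upperˡ) (·-monoˡ N (⊑-trans ⊔-upperˡ ⊔-upperʳ)) ⟩
      π · N ∎
      where
      N = M ⊓ ‾ m
      off-m : (M ⊓ ‾ u) ⊓ ‾ m ⊑ d · N
      off-m = ⊑-trans (⊓-glb (⊓-glb ⊓-lowerʳ (⊑-trans ⊓-lowerˡ ⊓-lowerʳ)) (⊓-glb (⊑-trans ⊓-lowerˡ ⊓-lowerˡ) ⊓-lowerʳ))
                   (⊑-reflexive (sym (vec⊓𝟙· vw N)))
      X = m ⊓ ‾ u
      vX : vector X
      vX = vec-⊓ vm (vec-‾ vu)
      X⊑ : X ⊑ m · (⊤ · (u ⊓ ‾ m))
      X⊑ = begin
        X                                      ≡⟨ sym vX ⟩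
        X · ⊤                                  ≡⟨ cong (X ·_) (sym (pt-⊤ pu)) ⟩
        X · (⊤ · u)                            ≡⟨ cong (λ t → X · (⊤ · t)) (⊓-split u m) ⟩
        X · (⊤ · ((u ⊓ m) ⊔ (u ⊓ ‾ m)))        ≡⟨ trans (cong (X ·_) (·-distribˡ-⊔ _ _ _)) (·-distribˡ-⊔ _ _ _) ⟩
        X · (⊤ · (u ⊓ m)) ⊔ X · (⊤ · (u ⊓ ‾ m)) ≤⟨ ⊔-lub (⊑-trans X·u⊓m≡⊥ ⊥-least) (·-monoˡ _ ⊓-lowerˡ) ⟩
        m · (⊤ · (u ⊓ ‾ m)) ∎
        where
        X·u⊓m≡⊥ : X · (⊤ · (u ⊓ m)) ⊑ ⊥
        X·u⊓m≡⊥ = begin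
          X · (⊤ · (u ⊓ m))    ≤⟨ ⊓-glb (⊑-trans (·-monoʳ X ⊤-greatest) (⊑-reflexive vX))
                                        (⊑-trans (·-monoˡ _ ⊓-lowerˡ) (injective-vec-absorbs vm (pt-inj pm) (vec-⊓ vu vm) ⊓-lowerʳ)) ⟩
          X ⊓ (u ⊓ m)          ≤⟨ ⊓-mono ⊓-lowerʳ ⊓-lowerˡ ⟩
          ‾ u ⊓ u              ≡⟨ ⊓-complementˡ u ⟩
          ⊥ ∎
      at-m : (M ⊓ ‾ u) ⊓ ‾ (‾ m) ⊑ P · N
      at-m = begin
        (M ⊓ ‾ u) ⊓ ‾ (‾ m)          ≤⟨ ⊓-glb (⊑-trans ⊓-lowerʳ (⊑-reflexive (‾-involutive m))) (⊑-trans ⊓-lowerˡ ⊓-lowerʳ) ⟩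
        X                            ≤⟨ X⊑ ⟩
        m · (⊤ · (u ⊓ ‾ m))          ≤⟨ ·-monoʳ m (·-monoʳ ⊤ (⊓-glb ⊓-lowerˡ (⊓-glb (⊑-trans ⊓-lowerˡ uM) ⊓-lowerʳ))) ⟩
        m · (⊤ · (u ⊓ N))            ≡⟨ cong (m ·_) (sym (vecᵀ·vec vu N)) ⟩
        m · (u ᵀ · N)                ≡⟨ sym (·-assoc _ _ _) ⟩
        P · N ∎

  -- Composing i with the swap of m and iᵀ · s frees the rank m for the roots other than s.
  shrink-injection : ∀ {i R M M' s m} → injective i → univalent i → vector R → vector M →
          R ⊑ i · M → point s → s ⊑ R → point m → M ⊓ ‾ m ⊑ M' →
          ∃ λ i' → injective i' × univalent i' × (‾ s ⊓ R ⊑ i' · M')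
  shrink-injection {i} {R} {M} {M'} {s} {m} ii ui vR vM RiM ps sR pm MM' =
    i · π , inj , univ , cover
    where
    u = i ᵀ · s
    s⊑i⊤ : s ⊑ i · ⊤
    s⊑i⊤ = ⊑-trans sR (⊑-trans RiM (·-monoʳ i ⊤-greatest))
    pu : point u
    pu = univalent-image-pt ui ps s⊑i⊤
    u⊑M : u ⊑ M
    u⊑M = begin
      i ᵀ · s             ≤⟨ ·-monoʳ (i ᵀ) (⊑-trans sR RiM) ⟩
      i ᵀ · (i · M)       ≡⟨ sym (·-assoc _ _ _) ⟩
      (i ᵀ · i) · M       ≤⟨ ·-monoˡ M ui ⟩
      𝟙 · M               ≡⟨ ·-identityˡ M ⟩
      M ∎
    open Swap pm pu
    inj : injective (i · π)
    inj = injective-· ii (⊑-trans (⊑-reflexive (cong (π ·_) π-sym)) π-sq)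
    univ : univalent (i · π)
    univ = univalent-· ui (⊑-trans (⊑-reflexive (cong (_· π) π-sym)) π-sq)
    iu⊑s : i · u ⊑ s
    iu⊑s = begin
      i · (i ᵀ · s)       ≡⟨ sym (·-assoc _ _ _) ⟩
      (i · i ᵀ) · s       ≤⟨ ·-monoˡ s ii ⟩
      𝟙 · s               ≡⟨ ·-identityˡ s ⟩
      s ∎
    cover : ‾ s ⊓ R ⊑ (i · π) · M'
    cover = begin
      ‾ s ⊓ R                                ≤⟨ ⊓-mono ⊑-refl RiM ⟩
      ‾ s ⊓ i · M                            ≡⟨ cong (λ t → ‾ s ⊓ i · t) (⊓-split M u) ⟩
      ‾ s ⊓ i · ((M ⊓ u) ⊔ (M ⊓ ‾ u))        ≡⟨ cong (‾ s ⊓_) (·-distribˡ-⊔ _ _ _) ⟩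
      ‾ s ⊓ (i · (M ⊓ u) ⊔ i · (M ⊓ ‾ u))    ≤⟨ ⊓-mono ⊑-refl (⊔-mono (⊑-trans (·-monoʳ i ⊓-lowerʳ) iu⊑s) ⊑-refl) ⟩
      ‾ s ⊓ (s ⊔ i · (M ⊓ ‾ u))              ≤⟨ ⊑-trans (⊑-reflexive (⊓-comm _ _)) (shunting (⊔-mono (⊑-reflexive (sym (‾-involutive s))) ⊑-refl)) ⟩
      i · (M ⊓ ‾ u)                          ≤⟨ ·-monoʳ i (π-move vM u⊑M) ⟩
      i · (π · (M ⊓ ‾ m))                    ≤⟨ ·-monoʳ i (·-monoʳ π MM') ⟩
      i · (π · M')                           ≡⟨ sym (·-assoc _ _ _) ⟩
      (i · π) · M' ∎

  -- Ranks

  module Ranks (T : TarskiRule) {Z Sc : S} (pZ : point Z) (mS : mapping Sc) (iS : injective Sc)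
              (hS : ((Sc ᵀ) ⋆) · Z ≡ ⊤) where
    S' = Sc ⊓ ‾ (Z ᵀ)

    S'-univalent : S' ᵀ · S' ⊑ 𝟙
    S'-univalent = ⊑-trans (·-mono (ᵀ-mono ⊓-lowerˡ) ⊓-lowerˡ) (proj₁ mS)

    S'-injective : S' · S' ᵀ ⊑ 𝟙
    S'-injective = ⊑-trans (·-mono ⊓-lowerˡ (ᵀ-mono ⊓-lowerˡ)) iS

    Scᵀ⊑S'ᵀ⊔Z : Sc ᵀ ⊑ S' ᵀ ⊔ (Z ⊓ Sc ᵀ)
    Scᵀ⊑S'ᵀ⊔Z = begin
      Sc ᵀ                                     ≡⟨ cong _ᵀ (⊓-split Sc (‾ (Z ᵀ))) ⟩
      (S' ⊔ (Sc ⊓ ‾ (‾ (Z ᵀ)))) ᵀ              ≡⟨ ᵀ-⊔ _ _ ⟩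
      S' ᵀ ⊔ (Sc ⊓ ‾ (‾ (Z ᵀ))) ᵀ              ≡⟨ cong (λ t → S' ᵀ ⊔ (Sc ⊓ t) ᵀ) (‾-involutive _) ⟩
      S' ᵀ ⊔ (Sc ⊓ Z ᵀ) ᵀ                      ≡⟨ cong (S' ᵀ ⊔_) (trans (ᵀ-⊓ _ _) (trans (cong (Sc ᵀ ⊓_) (ᵀ-invol Z)) (⊓-comm _ _))) ⟩
      S' ᵀ ⊔ (Z ⊓ Sc ᵀ) ∎

    -- Removing the edges back into Z does not change what is reachable from Z.
    S'ᵀ⋆·Z≡⊤ : (S' ᵀ) ⋆ · Z ≡ ⊤
    S'ᵀ⋆·Z≡⊤ = ⊑-antisym ⊤-greatest (⊑-trans (⊑-reflexive (sym hS)) (⋆-indˡ Z⊑W step))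
      where
      W = (S' ᵀ) ⋆ · Z
      Z⊑W : Z ⊑ W
      Z⊑W = ⊑-trans (⊑-reflexive (sym (·-identityˡ Z))) (·-monoˡ Z ⋆-refl)
      step : Sc ᵀ · W ⊑ W
      step = begin
        Sc ᵀ · W                             ≤⟨ ·-monoˡ W Scᵀ⊑S'ᵀ⊔Z ⟩
        (S' ᵀ ⊔ (Z ⊓ Sc ᵀ)) · W              ≡⟨ ·-distribʳ-⊔ _ _ _ ⟩
        S' ᵀ · W ⊔ (Z ⊓ Sc ᵀ) · W            ≡⟨ cong (S' ᵀ · W ⊔_) (vec-⊓· (pt-vec pZ) _ _) ⟩
        S' ᵀ · W ⊔ (Z ⊓ Sc ᵀ · W)            ≤⟨ ⊔-lub (⊑-trans (⊑-reflexive (sym (·-assoc _ _ _))) (·-monoˡ Z ⋆-stepˡ)) (⊑-trans ⊓-lowerˡ Z⊑W) ⟩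
        W ∎

    S'ᵀ⋆ᵀ≡S'⋆ : ((S' ᵀ) ⋆) ᵀ ≡ S' ⋆
    S'ᵀ⋆ᵀ≡S'⋆ = trans (⋆-ᵀ _) (cong _⋆ (ᵀ-invol S'))

    Z⊑S'⋆· : ∀ {m} → point m → Z ⊑ S' ⋆ · m
    Z⊑S'⋆· {m} pm = ⊑-trans (pt-dual pm pZ ((S' ᵀ) ⋆) (⊑-trans ⊤-greatest (⊑-reflexive (sym S'ᵀ⋆·Z≡⊤)))) (⊑-reflexive (cong (_· m) S'ᵀ⋆ᵀ≡S'⋆))

    ranks-comparable : ∀ {n m} → point n → point m → n ⊑ (m ⊔ S' ⁺ · m) ⊔ (S' ᵀ) ⁺ · m
    ranks-comparable {n} {m} pn pm = begin
      n                                    ≤⟨ ⊤-greatest ⟩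
      ⊤                                    ≡⟨ sym S'ᵀ⋆·Z≡⊤ ⟩
      (S' ᵀ) ⋆ · Z                         ≤⟨ ·-monoʳ _ (Z⊑S'⋆· pm) ⟩
      (S' ᵀ) ⋆ · (S' ⋆ · m)                ≡⟨ sym (·-assoc _ _ _) ⟩
      ((S' ᵀ) ⋆ · S' ⋆) · m                ≤⟨ ·-monoˡ m (univalent-church-rosser S'-univalent) ⟩
      (S' ⋆ ⊔ (S' ᵀ) ⋆) · m                ≡⟨ ·-distribʳ-⊔ _ _ _ ⟩
      S' ⋆ · m ⊔ (S' ᵀ) ⋆ · m              ≡⟨ cong₂ _⊔_ (⋆-unfold-· S' m) (⋆-unfold-· (S' ᵀ) m) ⟩
      (m ⊔ S' ⁺ · m) ⊔ (m ⊔ (S' ᵀ) ⁺ · m)  ≤⟨ ⊔-lub ⊔-upperˡ (⊔-lub (⊑-trans ⊔-upperˡ ⊔-upperˡ) ⊔-upperʳ) ⟩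
      (m ⊔ S' ⁺ · m) ⊔ (S' ᵀ) ⁺ · m        ∎

    no-successor⇒⊤⊑S'⋆ : ∀ {m} → point m → S' ᵀ · m ≡ ⊥ → ⊤ ⊑ S' ⋆ · m
    no-successor⇒⊤⊑S'⋆ {m} pm no-successor = ⊑-trans (⊑-reflexive (sym S'ᵀ⋆·Z≡⊤)) (⋆-indˡ (Z⊑S'⋆· pm) (begin
      S' ᵀ · (S' ⋆ · m)                    ≡⟨ cong (S' ᵀ ·_) (⋆-unfold-· S' m) ⟩
      S' ᵀ · (m ⊔ S' ⁺ · m)                ≡⟨ ·-distribˡ-⊔ _ _ _ ⟩
      S' ᵀ · m ⊔ S' ᵀ · (S' ⁺ · m)         ≡⟨ cong (_⊔ S' ᵀ · (S' ⁺ · m)) no-successor ⟩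
      ⊥ ⊔ S' ᵀ · (S' ⁺ · m)                ≡⟨ ⊔-identityˡ _ ⟩
      S' ᵀ · ((S' · S' ⋆) · m)             ≡⟨ trans (cong (S' ᵀ ·_) (·-assoc _ _ _)) (sym (·-assoc _ _ _)) ⟩
      (S' ᵀ · S') · (S' ⋆ · m)             ≤⟨ ·-monoˡ _ S'-univalent ⟩
      𝟙 · (S' ⋆ · m)                       ≡⟨ ·-identityˡ _ ⟩
      S' ⋆ · m                             ∎))

    S'ᵀ⁺ᵀ≡S'⁺ : ((S' ᵀ) ⁺) ᵀ ≡ S' ⁺
    S'ᵀ⁺ᵀ≡S'⁺ = trans (⁺-ᵀ (S' ᵀ)) (cong _⁺ (ᵀ-invol S'))

    rank-trichotomy : ∀ {m n} → point m → point n → ¬ (m ⊑ S' ⁺ · n) → ¬ (m ≡ n) → n ⊑ S' ⁺ · m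
    rank-trichotomy {m} {n} pm pn m≮n m≢n = pt-meets⇒⊑ pn T (·-vec _ (pt-vec pm)) meets-above
      where
      meets-above : ¬ (n ⊓ S' ⁺ · m ≡ ⊥)
      meets-above disjoint-above = m≮n (begin
        m                  ≤⟨ pt-dual pn pm ((S' ᵀ) ⁺) (pt-meets⇒⊑ pn T (·-vec _ (pt-vec pm)) meets-below) ⟩
        ((S' ᵀ) ⁺) ᵀ · n   ≡⟨ cong (_· n) S'ᵀ⁺ᵀ≡S'⁺ ⟩
        S' ⁺ · n           ∎)
        where
        meets-below : ¬ (n ⊓ (S' ᵀ) ⁺ · m ≡ ⊥)
        meets-below disjoint-below =
          m≢n (sym (pt-⊑⇒≡ pn pm (⊑⊔-disjoint (⊑⊔-disjoint (ranks-comparable pn pm) disjoint-below) disjoint-above)))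

    successor-pt : ∀ {m} → point m → ¬ (S' ᵀ · m ≡ ⊥) → point (S' ᵀ · m)
    successor-pt {m} pm ne =
      vz , injective-· (univalent⇒ᵀ-injective S'-univalent) (pt-inj pm) ,
      ⊤·≡⊤⇒surjective (trans (sym (trans (·-assoc _ _ _) (cong (⊤ ·_) vz))) (T _ ne))
      where
      vz : vector (S' ᵀ · m)
      vz = ·-vec _ (pt-vec pm)

    S'⁺·S'⊑S'⁺ : S' ⁺ · S' ⊑ S' ⁺
    S'⁺·S'⊑S'⁺ = begin
      (S' · S' ⋆) · S'      ≡⟨ ·-assoc _ _ _ ⟩
      S' · (S' ⋆ · S')      ≤⟨ ·-monoʳ S' ⋆-stepʳ ⟩
      S' · S' ⋆ ∎

    module RankIncrease {p₂ r s rank : S} (up : univalent p₂) (pr : point r) (ps : point s)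
                  (rR : r ⊑ roots p₂) (mr : mapping rank) (hq : loopFree p₂ · rank ⊑ rank · S' ⁺)
                  (geq : rank ᵀ · r ≡ rank ᵀ · s) (pz : point (S' ᵀ · (rank ᵀ · r))) where
      m = rank ᵀ · r
      z = S' ᵀ · m
      vr = pt-vec pr
      vs = pt-vec ps
      vz = pt-vec pz
      p₃ = upd p₂ s r
      rank' = upd rank r z
      q₂ = loopFree p₂

      zᵀ≡sᵀ·rank·S' : z ᵀ ≡ (s ᵀ · rank) · S'
      zᵀ≡sᵀ·rank·S' = begin-equality
        (S' ᵀ · m) ᵀ                ≡⟨ ᵀ-· (S' ᵀ) m ⟩
        m ᵀ · (S' ᵀ) ᵀ              ≡⟨ cong₂ _·_ (cong _ᵀ geq) (ᵀ-invol S') ⟩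
        (rank ᵀ · s) ᵀ · S'         ≡⟨ cong (_· S') (trans (ᵀ-· (rank ᵀ) s) (cong (s ᵀ ·_) (ᵀ-invol rank))) ⟩
        (s ᵀ · rank) · S' ∎

      zᵀ≡rᵀ·rank·S' : z ᵀ ≡ (r ᵀ · rank) · S'
      zᵀ≡rᵀ·rank·S' = trans (ᵀ-· (S' ᵀ) m) (cong₂ _·_ (trans (ᵀ-· (rank ᵀ) r) (cong (r ᵀ ·_) (ᵀ-invol rank))) (ᵀ-invol S'))

      loopFree₃ : loopFree p₃ ≡ (s · r ᵀ ⊓ ‾ 𝟙) ⊔ (‾ s ⊓ q₂)
      loopFree₃ = Update.upd-loopFree {p₂} {s} {r} vs vr

      loopFree₃⊑ : loopFree p₃ ⊑ s · r ᵀ ⊔ q₂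
      loopFree₃⊑ = ⊑-trans (⊑-reflexive loopFree₃) (⊔-mono ⊓-lowerˡ ⊓-lowerʳ)

      r⊓loopFree₃ : r ⊓ loopFree p₃ ≡ ⊥
      r⊓loopFree₃ = ⊑⊥⇒≡⊥ (begin
        r ⊓ loopFree p₃                                          ≡⟨ cong (r ⊓_) loopFree₃ ⟩
        r ⊓ ((s · r ᵀ ⊓ ‾ 𝟙) ⊔ (‾ s ⊓ q₂))                 ≡⟨ ⊓-distribˡ-⊔ _ _ _ ⟩
        (r ⊓ (s · r ᵀ ⊓ ‾ 𝟙)) ⊔ (r ⊓ (‾ s ⊓ q₂))           ≤⟨ ⊔-lub r⊓new-edge≡⊥ (⊑-trans (⊓-mono ⊑-refl ⊓-lowerʳ) (⊑-reflexive (⊓-loopFree≡⊥ up vr rR))) ⟩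
        ⊥ ∎)
        where
        r⊓new-edge≡⊥ : r ⊓ (s · r ᵀ ⊓ ‾ 𝟙) ⊑ ⊥
        r⊓new-edge≡⊥ = begin
          r ⊓ (s · r ᵀ ⊓ ‾ 𝟙)          ≡⟨ sym (⊓-assoc _ _ _) ⟩
          (r ⊓ s · r ᵀ) ⊓ ‾ 𝟙          ≡⟨ cong (λ t → (r ⊓ t) ⊓ ‾ 𝟙) (sym (vec-⊓-vecᵀ vs vr)) ⟩
          (r ⊓ (s ⊓ r ᵀ)) ⊓ ‾ 𝟙        ≡⟨ cong (_⊓ ‾ 𝟙) (trans (sym (⊓-assoc _ _ _)) (vec-⊓-vecᵀ (vec-⊓ vr vs) vr)) ⟩
          ((r ⊓ s) · r ᵀ) ⊓ ‾ 𝟙        ≤⟨ ⊓-mono (⊑-trans (·-monoˡ (r ᵀ) ⊓-lowerˡ) (pt-inj pr)) ⊑-refl ⟩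
          𝟙 ⊓ ‾ 𝟙                      ≡⟨ ⊓-complementʳ 𝟙 ⟩
          ⊥ ∎

      rank'≡ : rank' ≡ r · z ᵀ ⊔ (‾ r ⊓ rank)
      rank'≡ = Update.upd-eq {rank} {r} {z} vr vz

      loopFree₃·rank'⊑ : loopFree p₃ · rank' ⊑ rank · S' ⁺
      loopFree₃·rank'⊑ = begin
        loopFree p₃ · rank'                                    ≤⟨ ·-mono loopFree₃⊑ (⊑-reflexive rank'≡) ⟩
        (s · r ᵀ ⊔ q₂) · (r · z ᵀ ⊔ (‾ r ⊓ rank))        ≡⟨ trans (·-distribʳ-⊔ _ _ _) (cong₂ _⊔_ (·-distribˡ-⊔ _ _ _) (·-distribˡ-⊔ _ _ _)) ⟩
        ((s · r ᵀ) · (r · z ᵀ) ⊔ (s · r ᵀ) · (‾ r ⊓ rank)) ⊔ (q₂ · (r · z ᵀ) ⊔ q₂ · (‾ r ⊓ rank))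
            ≤⟨ ⊔-lub (⊔-lub new-edge (≡⊥⇒⊑ new-edge-leaves-r)) (⊔-lub edges-into-r (⊑-trans (·-monoʳ q₂ ⊓-lowerʳ) hq)) ⟩
        rank · S' ⁺ ∎
        where
        new-edge : (s · r ᵀ) · (r · z ᵀ) ⊑ rank · S' ⁺
        new-edge = begin
          (s · r ᵀ) · (r · z ᵀ)       ≡⟨ trans (·-assoc _ _ _) (cong (s ·_) (sym (·-assoc _ _ _))) ⟩
          s · ((r ᵀ · r) · z ᵀ)       ≡⟨ cong (λ t → s · (t · z ᵀ)) (ptᵀpt pr) ⟩
          s · (⊤ · z ᵀ)               ≡⟨ cong (s ·_) (sym (vecᵀ≡⊤·vecᵀ vz)) ⟩
          s · z ᵀ                     ≡⟨ cong (s ·_) zᵀ≡sᵀ·rank·S' ⟩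
          s · ((s ᵀ · rank) · S')     ≡⟨ trans (cong (s ·_) (·-assoc _ _ _)) (sym (·-assoc _ _ _)) ⟩
          (s · s ᵀ) · (rank · S')     ≤⟨ ·-monoˡ _ (pt-inj ps) ⟩
          𝟙 · (rank · S')             ≡⟨ ·-identityˡ _ ⟩
          rank · S'                   ≤⟨ ·-monoʳ rank ⁺-incl ⟩
          rank · S' ⁺ ∎
        new-edge-leaves-r : (s · r ᵀ) · (‾ r ⊓ rank) ≡ ⊥
        new-edge-leaves-r = trans (·-assoc _ _ _) (trans (cong (s ·_) (vecᵀ·disjoint vr (vec-‾ vr) (⊓-complementʳ r) rank)) (·-zeroʳ s))
        edges-into-r : q₂ · (r · z ᵀ) ⊑ rank · S' ⁺
        edges-into-r = begin
          q₂ · (r · z ᵀ)                 ≡⟨ cong (λ t → q₂ · (r · t)) zᵀ≡rᵀ·rank·S' ⟩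
          q₂ · (r · ((r ᵀ · rank) · S')) ≡⟨ cong (q₂ ·_) (trans (cong (r ·_) (·-assoc _ _ _)) (sym (·-assoc _ _ _))) ⟩
          q₂ · ((r · r ᵀ) · (rank · S')) ≤⟨ ·-monoʳ q₂ (·-monoˡ _ (pt-inj pr)) ⟩
          q₂ · (𝟙 · (rank · S'))         ≡⟨ cong (q₂ ·_) (·-identityˡ _) ⟩
          q₂ · (rank · S')               ≡⟨ sym (·-assoc _ _ _) ⟩
          (q₂ · rank) · S'               ≤⟨ ·-monoˡ S' hq ⟩
          (rank · S' ⁺) · S'             ≡⟨ ·-assoc _ _ _ ⟩
          rank · (S' ⁺ · S')             ≤⟨ ·-monoʳ rank S'⁺·S'⊑S'⁺ ⟩
          rank · S' ⁺ ∎

      -- Only r changes rank, to the successor z of m: the new edge from s (of rank m) and the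
      -- old edges into r (from ranks below m) still lead to higher ranks.
      edges-respect-rank : loopFree p₃ · rank' ⊑ rank' · S' ⁺
      edges-respect-rank = begin
        loopFree p₃ · rank'                        ≡⟨ cong (_· rank') (sym (⊑⇒⊓ loopFree₃⊑‾r)) ⟩
        (loopFree p₃ ⊓ ‾ r) · rank'                ≡⟨ cong (_· rank') (⊓-comm _ _) ⟩
        (‾ r ⊓ loopFree p₃) · rank'                ≡⟨ vec-⊓· (vec-‾ vr) _ _ ⟩
        ‾ r ⊓ loopFree p₃ · rank'                  ≤⟨ ⊓-mono ⊑-refl loopFree₃·rank'⊑ ⟩
        ‾ r ⊓ rank · S' ⁺                    ≡⟨ sym (vec-⊓· (vec-‾ vr) _ _) ⟩
        (‾ r ⊓ rank) · S' ⁺                  ≤⟨ ·-monoˡ _ (⊑-trans ⊔-upperʳ (⊑-reflexive (sym rank'≡))) ⟩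
        rank' · S' ⁺ ∎
        where
        loopFree₃⊑‾r : loopFree p₃ ⊑ ‾ r
        loopFree₃⊑‾r = disjoint⇒⊑‾ (trans (⊓-comm _ _) r⊓loopFree₃)

      used-ranks-bound : (S' ⁺ · rank' ᵀ) · ⊤ ⊑ (S' ⁺ · rank ᵀ) · ⊤ ⊔ m
      used-ranks-bound = begin
        (S' ⁺ · rank' ᵀ) · ⊤                    ≡⟨ ·-assoc _ _ _ ⟩
        S' ⁺ · (rank' ᵀ · ⊤)                    ≤⟨ ·-monoʳ _ rank'ᵀ·⊤⊑ ⟩
        S' ⁺ · (z ⊔ rank ᵀ · ⊤)                 ≡⟨ ·-distribˡ-⊔ _ _ _ ⟩
        S' ⁺ · z ⊔ S' ⁺ · (rank ᵀ · ⊤)          ≤⟨ ⊔-lub (⊑-trans S'⁺·z⊑ (⊔-lub ⊔-upperʳ (⊑-trans (·-monoʳ _ m⊑U) (⊑-trans (⊑-reflexive (sym (·-assoc _ _ _))) ⊔-upperˡ)))) (⊑-trans (⊑-reflexive (sym (·-assoc _ _ _))) ⊔-upperˡ) ⟩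
        (S' ⁺ · rank ᵀ) · ⊤ ⊔ m ∎
        where
        m⊑U : m ⊑ rank ᵀ · ⊤
        m⊑U = ·-monoʳ (rank ᵀ) ⊤-greatest
        rank'ᵀ·⊤⊑ : rank' ᵀ · ⊤ ⊑ z ⊔ rank ᵀ · ⊤
        rank'ᵀ·⊤⊑ = begin
          rank' ᵀ · ⊤                       ≤⟨ ·-monoˡ ⊤ (ᵀ-mono (Update.upd⊑ {rank} {r} {z} vr vz)) ⟩
          (r · z ᵀ ⊔ rank) ᵀ · ⊤            ≡⟨ cong (_· ⊤) (trans (ᵀ-⊔ _ _) (cong (_⊔ rank ᵀ) (·ᵀ-ᵀ r z))) ⟩
          (z · r ᵀ ⊔ rank ᵀ) · ⊤            ≡⟨ ·-distribʳ-⊔ _ _ _ ⟩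
          (z · r ᵀ) · ⊤ ⊔ rank ᵀ · ⊤        ≡⟨ cong (_⊔ rank ᵀ · ⊤) (trans (·-assoc _ _ _) (trans (cong (z ·_) (ptᵀ⊤ pr)) vz)) ⟩
          z ⊔ rank ᵀ · ⊤ ∎
        S'⁺·z⊑ : S' ⁺ · z ⊑ m ⊔ S' ⁺ · m
        S'⁺·z⊑ = begin
          S' ⁺ · (S' ᵀ · m)                 ≡⟨ sym (·-assoc _ _ _) ⟩
          (S' ⁺ · S' ᵀ) · m                 ≡⟨ cong (λ t → (t · S' ᵀ) · m) (sym (⋆-slide S')) ⟩
          ((S' ⋆ · S') · S' ᵀ) · m          ≡⟨ cong (_· m) (·-assoc _ _ _) ⟩
          (S' ⋆ · (S' · S' ᵀ)) · m          ≤⟨ ·-monoˡ m (·-monoʳ _ S'-injective) ⟩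
          (S' ⋆ · 𝟙) · m                    ≡⟨ cong (_· m) (trans (·-identityʳ _) (⋆-unfold S')) ⟩
          (𝟙 ⊔ S' ⁺) · m                    ≡⟨ trans (·-distribʳ-⊔ _ _ _) (cong (_⊔ S' ⁺ · m) (·-identityˡ m)) ⟩
          m ⊔ S' ⁺ · m ∎

      free-ranks-shrink : ‾ ((S' ⁺ · rank ᵀ) · ⊤) ⊓ ‾ m ⊑ ‾ ((S' ⁺ · rank' ᵀ) · ⊤)
      free-ranks-shrink = ⊑-trans (⊑-reflexive (sym (‾-⊔ _ _))) (‾-antitone used-ranks-bound)

  -- The union operation

  module Union (fin : Finite S) (T : TarskiRule) {Z Sc : S} (pZ : point Z) (mS : mapping Sc)
               (iS : injective Sc) (hS : ((Sc ᵀ) ⋆) · Z ≡ ⊤)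
               {p₀ rank₀ x y : S} (fp₀ : forest p₀) (px : point x) (py : point y)
               (mr : mapping rank₀) (hq₀ : loopFree p₀ · rank₀ ⊑ rank₀ · (Sc ⊓ ‾ (Z ᵀ)) ⁺)
               {i : S} (ii : injective i) (ui : univalent i)
               (cover₀ : roots p₀ ⊑ i · ‾ (((Sc ⊓ ‾ (Z ᵀ)) ⁺ · rank₀ ᵀ) · ⊤)) where
    open Ranks T pZ mS iS hS

    module Cx = PathCompression fin fp₀ px
    module Cy = PathCompression fin Cx.pc-forest py

    r s p₂ : S
    r = Cx.r
    s = Cy.r
    p₂ = Cy.p'

    fp₂ : forest p₂
    fp₂ = Cy.pc-forest

    pr : point r
    pr = Cx.r-pt

    ps : point s
    ps = Cy.r-pt

    roots₂ : roots p₂ ≡ roots p₀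
    roots₂ = trans Cy.pc-roots Cx.pc-roots

    r⊑roots : r ⊑ roots p₂
    r⊑roots = ⊑-trans Cx.r⊑roots (⊑-reflexive (sym roots₂))

    s⊑roots : s ⊑ roots p₂
    s⊑roots = ⊑-trans Cy.r⊑roots (⊑-reflexive (sym Cy.pc-roots))

    E₂ : E p₂ ≡ E p₀
    E₂ = trans Cy.pc-E Cx.pc-E

    x⊑Er : x ⊑ E p₀ · r
    x⊑Er = ⊑-trans Cx.x⊑p⋆r (·-monoˡ r E-⋆)

    y⊑Es : y ⊑ E p₀ · s
    y⊑Es = ⊑-trans Cy.x⊑p⋆r (⊑-trans (·-monoˡ s E-⋆) (⊑-reflexive (cong (_· s) Cx.pc-E)))

    hq₂ : loopFree p₂ · rank₀ ⊑ rank₀ · S' ⁺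
    hq₂ = Cy.pc-rank (Cx.pc-rank hq₀)

    free₀ : S
    free₀ = ‾ ((S' ⁺ · rank₀ ᵀ) · ⊤)

    cover₂ : roots p₂ ⊑ i · free₀
    cover₂ = ⊑-trans (⊑-reflexive roots₂) cover₀

    open UnionEquivalence px py pr ps x⊑Er y⊑Es

    Invariant : S → S → Set a
    Invariant p rank = forest p × point x × point y
      × ((p ⋆) · ((p ᵀ) ⋆) ≡ (p₀ ⊔ (x · (y ᵀ)) ⊔ ((p₀ ⊔ (x · (y ᵀ))) ᵀ)) ⋆)
      × rankProperty S' p rank

    invariant : ∀ {p rank} → forest p → E p ≡ E W → rankProperty S' p rank → Invariant p rank
    invariant fp Ep≡EW rp = fp , px , py ,
      trans (univalent⇒⋆·ᵀ⋆≡E (proj₁ (proj₁ fp))) (trans Ep≡EW (cong _⋆ (⊔-assoc _ _ _))) , rp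

    module Link {u v : S} (pu : point u) (pv : point v) (u⊑roots : u ⊑ roots p₂) (v⊑roots : v ⊑ roots p₂)
                (joins : E (p₀ ⊔ u · v ᵀ) ≡ E W) where
      open Linking fp₂ pu pv u⊑roots v⊑roots public

      E-linked : E p' ≡ E W
      E-linked = trans lk-E (trans (E-⊔-cong E₂) joins)

      invariant-same-rank : rank₀ ᵀ · u ⊑ S' ⁺ · (rank₀ ᵀ · v) → Invariant p' rank₀
      invariant-same-rank u<v = invariant lk-forest E-linked
        (mr , lk-rank hq₂ (edge-rank mr pu pv u<v) , i , ii , ui , ⊑-trans lk-roots⊑ cover₂)

    m : S
    m = rank₀ ᵀ · r

    pm : point m
    pm = mapping-image-pt mr pr

    -- If the rank m of r had no successor it would be the largest rank, so m would be the only
    -- rank not below a used one; the injection i would then send both roots r and s to m.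
    rank-has-successor : ¬ (r ≡ s) → ¬ (S' ᵀ · m ≡ ⊥)
    rank-has-successor r≢s no-successor =
      r≢s (pt-⊑⇒≡ pr ps (pt-⊑-under-injective pr ps (injective-· ii (pt-inj pm)) (below r⊑roots) (below s⊑roots)))
      where
      used = (S' ⁺ · rank₀ ᵀ) · ⊤
      ⊤⊑m⊔used : ⊤ ⊑ m ⊔ used
      ⊤⊑m⊔used = begin
        ⊤                  ≤⟨ no-successor⇒⊤⊑S'⋆ pm no-successor ⟩
        S' ⋆ · m           ≡⟨ ⋆-unfold-· S' m ⟩
        m ⊔ S' ⁺ · m       ≤⟨ ⊔-mono ⊑-refl (⊑-trans (·-monoʳ _ (·-monoʳ _ ⊤-greatest)) (⊑-reflexive (sym (·-assoc _ _ _)))) ⟩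
        m ⊔ used           ∎
      free⊑m : free₀ ⊑ m
      free⊑m = ⊑⊔-disjoint (⊑-trans ⊤-greatest ⊤⊑m⊔used) (⊓-complementˡ used)
      below : ∀ {t} → t ⊑ roots p₂ → t ⊑ i · m
      below t⊑roots = ⊑-trans t⊑roots (⊑-trans cover₂ (·-monoʳ i free⊑m))

    rank-increase : ¬ (r ≡ s) → rank₀ ᵀ · r ≡ rank₀ ᵀ · s →
                    Invariant (upd p₂ s r) (upd rank₀ r (S' ᵀ · m))
    rank-increase r≢s same-rank =
      let i′ , ii′ , ui′ , cover′ = shrink-injection ii ui (roots-vec p₂) (vec-‾ (x·⊤-vec _)) cover₂
                                      ps s⊑roots pm R.free-ranks-shrink
      in invariant L.lk-forest L.E-linked
           (upd-mapping mr (pt-vec pr) pz , R.edges-respect-rank , i′ , ii′ , ui′ , ⊑-trans roots-linked cover′)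
      where
      module L = Link ps pr s⊑roots r⊑roots E-linking-s-r
      pz : point (S' ᵀ · m)
      pz = successor-pt pm (rank-has-successor r≢s)
      module R = RankIncrease (proj₁ (proj₁ fp₂)) pr ps r⊑roots mr hq₂ same-rank pz
      roots-linked : roots L.p' ⊑ ‾ s ⊓ roots p₂
      roots-linked = begin
        roots L.p'                         ≡⟨ L.lk-roots ⟩
        (s ⊓ r) ⊔ (‾ s ⊓ roots p₂)         ≡⟨ cong (_⊔ (‾ s ⊓ roots p₂)) (distinct-pts-disjoint T ps pr (r≢s ∘ sym)) ⟩
        ⊥ ⊔ (‾ s ⊓ roots p₂)               ≡⟨ ⊔-identityˡ _ ⟩
        ‾ s ⊓ roots p₂                     ∎

    union-correct : ∀ {p rank} → Exec S' x y p₀ rank₀ p rank → Invariant p rank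
    union-correct (same r≡s) =
      invariant fp₂ (trans E₂ (E-same-root r≡s)) (mr , hq₂ , i , ii , ui , cover₂)
    union-correct (link-r→s _ r≤s) =
      Link.invariant-same-rank pr ps r⊑roots s⊑roots E-linking-r-s (⊑-trans r≤s (⊑-reflexive (·-assoc _ _ _)))
    union-correct (link-s→r-neq _ r≰s r≢s) =
      Link.invariant-same-rank ps pr s⊑roots r⊑roots E-linking-s-r
        (rank-trichotomy pm (mapping-image-pt mr ps) (r≰s ∘ (λ h → ⊑-trans h (⊑-reflexive (sym (·-assoc _ _ _))))) r≢s)
    union-correct (link-s→r-eq r≢s _ same-rank) = rank-increase r≢s same-rank

mainTheorem20 : ∀ {a : Level} (K : KleeneRelationAlgebra a) → let open KRA K in
    Finite S → TarskiRule →
    (Z Sc : S) → point Z → mapping Sc → injective Sc → ((Sc ᵀ) ⋆) · Z ≡ ⊤ₛ →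
    (p₀ rank₀ x y : S) → forest p₀ → point x → point y →
    rankProperty (Sc ⊓ ‾ (Z ᵀ)) p₀ rank₀ →
    (p rank : S) → Exec (Sc ⊓ ‾ (Z ᵀ)) x y p₀ rank₀ p rank →
    forest p × point x × point y
    × ((p ⋆) · ((p ᵀ) ⋆) ≡ (p₀ ⊔ₛ (x · (y ᵀ)) ⊔ₛ ((p₀ ⊔ₛ (x · (y ᵀ))) ᵀ)) ⋆)
    × rankProperty (Sc ⊓ ‾ (Z ᵀ)) p rank
mainTheorem20 K fin T Z Sc pZ mS iS hS p₀ rank₀ x y fp₀ px py (mr , hq₀ , i , ii , ui , cover₀) p rank run =
  Union.union-correct fin T pZ mS iS hS fp₀ px py mr hq₀ ii ui cover₀ run
  where open Properties K
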